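{- Let $p$ be an odd prime and $d$ a positive integer with $p\equiv-1\pmod d$. Then for every integer $0\le n\le p-2$, \[ \frac{\Gamma_p(\langle-\frac1d+\frac{n}{p-1}\rangle)\Gamma_p(\langle-\frac{d-1}{d}+\frac{n}{p-1}\rangle)\Gamma_p(\langle\frac1d-\frac{n}{p-1}\rangle)\Gamma_p(\langle\frac{d-1}{d}-\frac{n}{p-1}\rangle)}{\Gamma_p(\langle\frac1d\rangle)^2\Gamma_p(\langle\frac{d-1}{d}\rangle)^2}=1. \]
   Context: $\Gamma_p$ denotes Morita's $p$-adic gamma function (with $\Gamma_p(0)=1$). For $y\in\mathbb{Q}$, $\lfloor y\rfloor$ is the floor and $\langle y\rangle=y-\lfloor y\rfloor$. -}

module Defs where

open import Data.Nat as ℕ using (ℕ; zero; suc)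
open import Data.Nat.Divisibility as ℕD using ()
open import Data.Integer as ℤ using (ℤ; +_)
open import Data.Rational as ℚ using (ℚ; ↥_; ↧_; floor)
open import Data.Bool using (Bool; true; false; if_then_else_)
open import Relation.Nullary.Decidable using (does)

-- a / b as a rational, for b a natural number (only ever used with b > 0;
-- returns 0 for b = 0 so that no NonZero instance must be threaded)
_÷ℕ_ : ℤ → ℕ → ℚ
a ÷ℕ zero = ℚ.0ℚ
a ÷ℕ suc b = a ℚ./ suc b

frac : ℚ → ℚ
frac y = y ℚ.- (floor y ℚ./ 1)

-- Morita's p-adic gamma at a natural number N:
--   Γ_p(0) = 1,  Γ_p(N+1) = -Γ_p(N)   if p ∣ N,
--                Γ_p(N+1) = -N·Γ_p(N) otherwise,
-- i.e. Γ_p(N) = (-1)^N ∏_{0<j<N, p∤j} j.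
ΓpNat : ℕ → ℕ → ℤ
ΓpNat p zero = + 1
ΓpNat p (suc N) = ℤ.- (ΓpNat p N ℤ.* (if does (p ℕD.∣? N) then + 1 else + N))

anyBelow : ℕ → (ℕ → Bool) → Bool
anyBelow zero P = false
anyBelow (suc c) P = if P c then true else anyBelow c P

-- least N < b with P N (0 if none)
firstBelow : ℕ → (ℕ → Bool) → ℕ
firstBelow zero P = 0
firstBelow (suc b) P =
  if anyBelow b P then firstBelow b P else (if P b then b else 0)

-- the residue in [0, m) of a rational q = a/b (b invertible mod m):
-- the least N < m with m ∣ b·N - a
residue : ℕ → ℚ → ℕ
residue m q = firstBelow m (λ N → does (m ℕD.∣? ℤ.∣ (↧ q) ℤ.* (+ N) ℤ.- (↥ q) ∣))

-- Γ_p(q) modulo p^k, for q ∈ ℚ ∩ ℤ_p: since Γ_p is 1-Lipschitz,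
-- Γ_p(q) ≡ Γ_p(N) (mod p^k) whenever N ≡ q (mod p^k).
ΓpMod : (p k : ℕ) → ℚ → ℤ
ΓpMod p k q = ΓpNat p (residue (p ℕ.^ k) q)

{-# OPTIONS --safe #-}
-- For x = c/D with D ≡ −1 (mod p) and 0 < c < D, let N and N̄ be the residues of x and
-- 1 − x modulo m = p^(k+1).  Up to sign, Γ_p(N) is the product of the integers below N
-- prime to p.  Reflecting the factors of Γ_p(N̄) through j ↦ m − j turns Γ_p(N) Γ_p(N̄)
-- into (−1)^(c mod p) times the product of all units below m, which is −1 by Wilson's
-- theorem for p^(k+1): every unit pairs off with its inverse except ±1.  Hence
-- Γ_p(x) Γ_p(1 − x) ≡ −(−1)^(c mod p).
--
-- As d ∣ p + 1, all six arguments of the theorem have denominator p² − 1.  The four in the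
-- numerator form two pairs x, −x, and the two in the denominator form one pair x, 1 − x,
-- so each pair contributes a sign.  The second pair of the numerator is p times the first
-- modulo 1, and multiplying by p swaps the two base-p digits of the numerator c < p² − 1
-- of the first; c is even because p is odd, so the digits have equal parity and both pairs
-- carry the same sign.  The quotient is therefore a ratio of squares of signs.

module Submission where

open import Defs
open import Data.Nat as ℕ using (ℕ; zero; suc; z≤n; s≤s; NonZero)
import Data.Nat.Properties as ℕP
import Data.Nat.DivMod as ℕDM
open import Data.Nat.Divisibility as ℕD using () renaming (_∣_ to _∣ℕ_)
open import Data.Nat.Primality using (Prime; prime⇒irreducible; prime⇒nonZero; prime⇒nonTrivial; euclidsLemma)
open import Data.Nat.Coprimality as Coprimality using (Coprime; coprime-Bézout)
open import Data.Nat.GCD using (module Bézout)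
open import Data.Bool using (Bool; true; false; if_then_else_; _∧_; not)
open import Data.Bool.Properties using (∧-identityʳ; ∧-zeroʳ; ¬-not)
open import Data.Integer as ℤ using (ℤ; +_; -_; _+_; _*_; _-_; ∣_∣; _^_; -1ℤ)
import Data.Integer.Properties as ℤP
import Data.Integer.DivMod as ℤDM
open import Data.Integer.Divisibility.Signed
  using (_∣_; divides; ∣⇒∣ᵤ; ∣ᵤ⇒∣; ∣-refl; ∣-trans; ∣m∣n⇒∣m+n; ∣m⇒∣-m; ∣n⇒∣m*n)
open import Data.Integer.Tactic.RingSolver using (solve-∀)
import Data.Nat.Tactic.RingSolver as ℕSolver
open import Data.Rational as ℚ using (ℚ; mkℚ; ↥_; ↧_; ↧ₙ_; toℚᵘ)
import Data.Rational.Properties as ℚP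
open import Data.Rational.Unnormalised as ℚᵘ using (mkℚᵘ) renaming (↥_ to ↥ᵘ_; ↧_ to ↧ᵘ_)
open import Data.Sum using (_⊎_; inj₁; inj₂; [_,_]′)
open import Data.Product using (∃-syntax; _,_; proj₁; proj₂; _×_)
open import Level using (0ℓ)
open import Relation.Binary.Bundles using (Setoid)
import Relation.Binary.Reasoning.Setoid as SetoidReasoning
open import Relation.Nullary using (¬_; contradiction; Dec; does; yes; no)
open import Relation.Nullary.Decidable using (dec-true; dec-false)
open import Function using (_∘_; _$_; id)
open import Relation.Binary.PropositionalEquality
import Data.Integer.Divisibility as ℤD

infix 4 _≡_mod_
record _≡_mod_ (a b : ℤ) (m : ℕ) : Set where
  constructor ≡-mod
  field ∣-diff : + m ∣ a - b
open _≡_mod_ public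

module _ {m : ℕ} where

  ≡-mod-reflexive : ∀ {a b} → a ≡ b → a ≡ b mod m
  ≡-mod-reflexive {a} refl = ≡-mod (divides (+ 0) (ℤP.+-inverseʳ a))

  ≡-mod-refl : ∀ {a} → a ≡ a mod m
  ≡-mod-refl = ≡-mod-reflexive refl

  ≡-mod-sym : ∀ {a b} → a ≡ b mod m → b ≡ a mod m
  ≡-mod-sym {a} {b} (≡-mod h) = ≡-mod (subst (+ m ∣_) (negate a b) (∣m⇒∣-m h))
    where
    negate : ∀ a b → - (a - b) ≡ b - a
    negate = solve-∀

  ≡-mod-trans : ∀ {a b c} → a ≡ b mod m → b ≡ c mod m → a ≡ c mod m
  ≡-mod-trans {a} {b} {c} (≡-mod h) (≡-mod h′) =
    ≡-mod (subst (+ m ∣_) (telescope a b c) (∣m∣n⇒∣m+n h h′))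
    where
    telescope : ∀ a b c → (a - b) + (b - c) ≡ a - c
    telescope = solve-∀

≡-mod-setoid : ℕ → Setoid 0ℓ 0ℓ
≡-mod-setoid m = record
  { Carrier = ℤ
  ; _≈_ = λ a b → a ≡ b mod m
  ; isEquivalence = record { refl = ≡-mod-refl ; sym = ≡-mod-sym ; trans = ≡-mod-trans }
  }

module ≡-mod-Reasoning (m : ℕ) = SetoidReasoning (≡-mod-setoid m)

module _ {m : ℕ} where

  ∣⇒≡0-mod : ∀ {a} → + m ∣ a → a ≡ + 0 mod m
  ∣⇒≡0-mod {a} h = ≡-mod (subst (+ m ∣_) (sym (ℤP.+-identityʳ a)) h)

  ≡0-mod⇒∣ : ∀ {a} → a ≡ + 0 mod m → + m ∣ a
  ≡0-mod⇒∣ {a} (≡-mod h) = subst (+ m ∣_) (ℤP.+-identityʳ a) h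

  +-cong-mod : ∀ {a b c d} → a ≡ b mod m → c ≡ d mod m → a + c ≡ b + d mod m
  +-cong-mod {a} {b} {c} {d} (≡-mod h) (≡-mod h′) =
    ≡-mod (subst (+ m ∣_) (regroup a b c d) (∣m∣n⇒∣m+n h h′))
    where
    regroup : ∀ a b c d → (a - b) + (c - d) ≡ (a + c) - (b + d)
    regroup = solve-∀

  neg-cong-mod : ∀ {a b} → a ≡ b mod m → - a ≡ - b mod m
  neg-cong-mod {a} {b} (≡-mod h) = ≡-mod (subst (+ m ∣_) (regroup a b) (∣m⇒∣-m h))
    where
    regroup : ∀ a b → - (a - b) ≡ - a - - b
    regroup = solve-∀

  *-cong-mod : ∀ {a b c d} → a ≡ b mod m → c ≡ d mod m → a * c ≡ b * d mod m
  *-cong-mod {a} {b} {c} {d} (≡-mod h) (≡-mod h′) =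
    ≡-mod (subst (+ m ∣_) (regroup a b c d) (∣m∣n⇒∣m+n (∣n⇒∣m*n a h′) (∣n⇒∣m*n d h)))
    where
    regroup : ∀ a b c d → a * (c - d) + d * (a - b) ≡ a * c - b * d
    regroup = solve-∀

  *-congˡ-mod : ∀ a {c d} → c ≡ d mod m → a * c ≡ a * d mod m
  *-congˡ-mod a = *-cong-mod {a = a} ≡-mod-refl

  *-congʳ-mod : ∀ c {a b} → a ≡ b mod m → a * c ≡ b * c mod m
  *-congʳ-mod c h = *-cong-mod {c = c} h ≡-mod-refl

≡-mod-∣ : ∀ {m n a b} → n ∣ℕ m → a ≡ b mod m → a ≡ b mod n
≡-mod-∣ n∣m (≡-mod h) = ≡-mod (∣-trans (∣ᵤ⇒∣ n∣m) h)

∸-divisible⇒%-≡ : ∀ {M a b} .{{_ : NonZero M}} → b ℕ.≤ a → M ∣ℕ a ℕ.∸ b → a ℕ.% M ≡ b ℕ.% M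
∸-divisible⇒%-≡ {M} {a} {b} b≤a (ℕD.divides q a∸b≡qM) = begin
  a ℕ.% M                  ≡⟨ cong (ℕ._% M) (ℕP.m+[n∸m]≡n b≤a) ⟨
  (b ℕ.+ (a ℕ.∸ b)) ℕ.% M  ≡⟨ cong (λ x → (b ℕ.+ x) ℕ.% M) a∸b≡qM ⟩
  (b ℕ.+ q ℕ.* M) ℕ.% M    ≡⟨ ℕDM.[m+kn]%n≡m%n b q M ⟩
  b ℕ.% M                  ∎
  where open ≡-Reasoning

∣+m-+n∣≡n∸m : ∀ {m n} → m ℕ.≤ n → ∣ + m - + n ∣ ≡ n ℕ.∸ m
∣+m-+n∣≡n∸m {m} {n} m≤n = trans (cong ∣_∣ (ℤP.m-n≡m⊖n m n)) (ℤP.∣⊖∣-≤ m≤n)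

≡-mod⇒%-≡ : ∀ {M a b} .{{_ : NonZero M}} → + a ≡ + b mod M → a ℕ.% M ≡ b ℕ.% M
≡-mod⇒%-≡ {M} {a} {b} h with ∣⇒∣ᵤ (∣-diff h) | ℕP.≤-total a b
... | M∣∣a-b∣ | inj₁ a≤b =
  sym (∸-divisible⇒%-≡ a≤b (subst (M ∣ℕ_) (∣+m-+n∣≡n∸m a≤b) M∣∣a-b∣))
... | M∣∣a-b∣ | inj₂ b≤a =
  ∸-divisible⇒%-≡ b≤a (subst (M ∣ℕ_) (trans (ℤP.∣i-j∣≡∣j-i∣ (+ a) (+ b)) (∣+m-+n∣≡n∸m b≤a)) M∣∣a-b∣)

≡-mod⇒≡ : ∀ {M a b} → a ℕ.< M → b ℕ.< M → + a ≡ + b mod M → a ≡ b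
≡-mod⇒≡ {M} {a} {b} a<M b<M h = begin
  a        ≡⟨ ℕDM.m<n⇒m%n≡m a<M ⟨
  a ℕ.% M  ≡⟨ ≡-mod⇒%-≡ h ⟩
  b ℕ.% M  ≡⟨ ℕDM.m<n⇒m%n≡m b<M ⟩
  b        ∎
  where
  open ≡-Reasoning
  instance
    M≢0 : NonZero M
    M≢0 = ℕ.>-nonZero (ℕP.<-≤-trans (s≤s z≤n) a<M)

suc-% : ∀ t {p} .{{_ : NonZero p}} → suc t ℕ.% p ≡ suc (t ℕ.% p) ℕ.% p
suc-% t {p} = begin
  suc t ℕ.% p                                 ≡⟨ cong (λ n → suc n ℕ.% p) (ℕDM.m≡m%n+[m/n]*n t p) ⟩
  (suc (t ℕ.% p) ℕ.+ (t ℕ./ p) ℕ.* p) ℕ.% p   ≡⟨ ℕDM.[m+kn]%n≡m%n (suc (t ℕ.% p)) (t ℕ./ p) p ⟩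
  suc (t ℕ.% p) ℕ.% p                         ∎
  where open ≡-Reasoning

+-≡-mod⇒≡⊎≡+ : ∀ {M a b r} → a ℕ.< M → b ℕ.< M → r ℕ.< M → + a + + b ≡ + r mod M →
               a ℕ.+ b ≡ r ⊎ a ℕ.+ b ≡ r ℕ.+ M
+-≡-mod⇒≡⊎≡+ {M} {a} {b} {r} a<M b<M r<M h with a ℕ.+ b ℕ.<? M
... | yes a+b<M = inj₁ (≡-mod⇒≡ a+b<M r<M (subst (_≡ + r mod M) (sym (ℤP.pos-+ a b)) h))
... | no a+b≮M =
  inj₂ (trans (sym (ℕP.m∸n+n≡m M≤a+b)) (cong (ℕ._+ M) (≡-mod⇒≡ a+b∸M<M r<M a+b∸M≡r)))
  where
  instance
    M≢0 : NonZero M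
    M≢0 = ℕ.>-nonZero (ℕP.<-≤-trans (s≤s z≤n) a<M)
  M≤a+b : M ℕ.≤ a ℕ.+ b
  M≤a+b = ℕP.≮⇒≥ a+b≮M
  a+b∸M<M : a ℕ.+ b ℕ.∸ M ℕ.< M
  a+b∸M<M = ℕP.m<n+o⇒m∸n<o (a ℕ.+ b) M (ℕP.+-mono-< a<M b<M)
  a+b∸M≡r : + (a ℕ.+ b ℕ.∸ M) ≡ + r mod M
  a+b∸M≡r = begin
    + (a ℕ.+ b ℕ.∸ M)  ≡⟨ ℤP.⊖-≥ M≤a+b ⟨
    (a ℕ.+ b) ℤ.⊖ M    ≡⟨ ℤP.m-n≡m⊖n (a ℕ.+ b) M ⟨
    + (a ℕ.+ b) - + M  ≡⟨ cong (_- + M) (ℤP.pos-+ a b) ⟩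
    + a + + b - + M    ≈⟨ +-cong-mod h (neg-cong-mod (∣⇒≡0-mod ∣-refl)) ⟩
    + r - + 0          ≡⟨ ℤP.+-identityʳ (+ r) ⟩
    + r                ∎
    where open ≡-mod-Reasoning M

-- Inverses modulo prime powers

record Invertible (m : ℕ) (a : ℤ) : Set where
  constructor invertible
  field
    inverse   : ℤ
    inverse-∙ : a * inverse ≡ + 1 mod m

cancel-mod : ∀ {m a x x′} → Invertible m a → a * x ≡ a * x′ mod m → x ≡ x′ mod m
cancel-mod {m} {a} {x} {x′} (invertible y ay≡1) ax≡ax′ = begin
  x              ≡⟨ ℤP.*-identityˡ x ⟨
  + 1 * x        ≈⟨ *-congʳ-mod x ay≡1 ⟨
  a * y * x      ≡⟨ swap a y x ⟩
  y * (a * x)    ≈⟨ *-congˡ-mod y ax≡ax′ ⟩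
  y * (a * x′)   ≡⟨ swap a y x′ ⟨
  a * y * x′     ≈⟨ *-congʳ-mod x′ ay≡1 ⟩
  + 1 * x′       ≡⟨ ℤP.*-identityˡ x′ ⟩
  x′             ∎
  where
  open ≡-mod-Reasoning m
  swap : ∀ a y x → a * y * x ≡ y * (a * x)
  swap = solve-∀

invertible-* : ∀ {M N a} → Invertible M a → Invertible N a → Invertible (M ℕ.* N) a
invertible-* {M} {N} {a} (invertible y (≡-mod (divides s ay-1≡sM)))
                         (invertible z (≡-mod (divides t az-1≡tN))) =
  invertible (y + z - a * y * z) $ ≡-mod (divides (- (s * t)) (begin
    a * (y + z - a * y * z) - + 1      ≡⟨ factor a y z ⟩
    - ((a * y - + 1) * (a * z - + 1))  ≡⟨ cong₂ (λ u v → - (u * v)) ay-1≡sM az-1≡tN ⟩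
    - ((s * + M) * (t * + N))          ≡⟨ regroup s t (+ M) (+ N) ⟩
    - (s * t) * (+ M * + N)            ≡⟨ cong (- (s * t) *_) (ℤP.pos-* M N) ⟨
    - (s * t) * + (M ℕ.* N)            ∎))
  where
  open ≡-Reasoning
  factor : ∀ a y z → a * (y + z - a * y * z) - + 1 ≡ - ((a * y - + 1) * (a * z - + 1))
  factor = solve-∀
  regroup : ∀ s t M N → - ((s * M) * (t * N)) ≡ - (s * t) * (M * N)
  regroup = solve-∀

%ℕ-≡-mod : ∀ x m .{{_ : NonZero m}} → + (x ℤ.%ℕ m) ≡ x mod m
%ℕ-≡-mod x m = ≡-mod (divides (- q) (begin
  r - x              ≡⟨ cong (_-_ r) (ℤDM.a≡a%ℕn+[a/ℕn]*n x m) ⟩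
  r - (r + q * + m)  ≡⟨ cancel r q (+ m) ⟩
  - q * + m          ∎))
  where
  open ≡-Reasoning
  r = + (x ℤ.%ℕ m)
  q = x ℤ./ℕ m
  cancel : ∀ r q m → r - (r + q * m) ≡ - q * m
  cancel = solve-∀

invertible⇒solvable : ∀ {m a} .{{_ : NonZero m}} → Invertible m a →
                      ∀ b → ∃[ N ] N ℕ.< m × a * + N ≡ b mod m
invertible⇒solvable {m} {a} (invertible y ay≡1) b = N , ℤDM.n%ℕd<d (y * b) m , (begin
  a * + N        ≈⟨ *-congˡ-mod a (%ℕ-≡-mod (y * b) m) ⟩
  a * (y * b)    ≡⟨ ℤP.*-assoc a y b ⟨
  a * y * b      ≈⟨ *-congʳ-mod b ay≡1 ⟩
  + 1 * b        ≡⟨ ℤP.*-identityˡ b ⟩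
  b              ∎)
  where
  open ≡-mod-Reasoning m
  N = (y * b) ℤ.%ℕ m

module _ {p : ℕ} (p-prime : Prime p) where

  ∤⇒coprime : ∀ {b} → ¬ p ∣ℕ b → Coprime p b
  ∤⇒coprime p∤b (i∣p , i∣b) with prime⇒irreducible p-prime i∣p
  ... | inj₁ i≡1 = i≡1
  ... | inj₂ refl = contradiction i∣b p∤b

  ∤⇒invertible-mod-prime : ∀ {b} → ¬ p ∣ℕ b → Invertible p (+ b)
  ∤⇒invertible-mod-prime {b} p∤b with coprime-Bézout (∤⇒coprime p∤b)
  ... | Bézout.+- x y 1+yb≡xp = invertible (- + y) $ ≡-mod (divides (- + x) (begin
    + b * - + y - + 1      ≡⟨ rearrange (+ b) (+ y) ⟩
    - (+ 1 + + y * + b)    ≡⟨ cong -_ (lift-+* 1 y b) ⟩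
    - + (1 ℕ.+ y ℕ.* b)    ≡⟨ cong (λ t → - + t) 1+yb≡xp ⟩
    - + (x ℕ.* p)          ≡⟨ cong -_ (ℤP.pos-* x p) ⟩
    - (+ x * + p)          ≡⟨ ℤP.neg-distribˡ-* (+ x) (+ p) ⟩
    - + x * + p            ∎))
    where
    open ≡-Reasoning
    rearrange : ∀ b y → b * - y - + 1 ≡ - (+ 1 + y * b)
    rearrange = solve-∀
    lift-+* : ∀ a y b → + a + + y * + b ≡ + (a ℕ.+ y ℕ.* b)
    lift-+* a y b = sym (trans (ℤP.pos-+ a (y ℕ.* b)) (cong (_+_ (+ a)) (ℤP.pos-* y b)))
  ... | Bézout.-+ x y 1+xp≡yb = invertible (+ y) $ ≡-mod (divides (+ x) (begin
    + b * + y - + 1        ≡⟨ cong (_- + 1) (ℤP.*-comm (+ b) (+ y)) ⟩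
    + y * + b - + 1        ≡⟨ cong (_- + 1) (ℤP.pos-* y b) ⟨
    + (y ℕ.* b) - + 1      ≡⟨ cong (λ t → + t - + 1) 1+xp≡yb ⟨
    + (1 ℕ.+ x ℕ.* p) - + 1 ≡⟨ cong (_- + 1) (ℤP.pos-+ 1 (x ℕ.* p)) ⟩
    + 1 + + (x ℕ.* p) - + 1 ≡⟨ cancel (+ (x ℕ.* p)) ⟩
    + (x ℕ.* p)            ≡⟨ ℤP.pos-* x p ⟩
    + x * + p              ∎))
    where
    open ≡-Reasoning
    cancel : ∀ t → + 1 + t - + 1 ≡ t
    cancel = solve-∀

  ∤⇒invertible-mod-prime^ : ∀ {b} → ¬ p ∣ℕ b → ∀ k → Invertible (p ℕ.^ k) (+ b)
  ∤⇒invertible-mod-prime^ {b} p∤b zero =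
    invertible (+ 0) (≡-mod (divides (+ b * + 0 - + 1) (sym (ℤP.*-identityʳ _))))
  ∤⇒invertible-mod-prime^ {b} p∤b (suc k) =
    invertible-* (∤⇒invertible-mod-prime p∤b) (∤⇒invertible-mod-prime^ p∤b k)

anyBelow-true : ∀ {c P j} → j ℕ.< c → P j ≡ true → anyBelow c P ≡ true
anyBelow-true {suc c} {P} {j} j<1+c Pj with P c in Pc | ℕP.m≤n⇒m<n∨m≡n (ℕP.≤-pred j<1+c)
... | true  | _ = refl
... | false | inj₁ j<c = anyBelow-true j<c Pj
... | false | inj₂ refl = contradiction (trans (sym Pj) Pc) λ ()

anyBelow-false : ∀ {c P} → (∀ {j} → j ℕ.< c → P j ≡ false) → anyBelow c P ≡ false
anyBelow-false {zero} none = refl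
anyBelow-false {suc c} none rewrite none (ℕP.n<1+n c) = anyBelow-false (none ∘ ℕP.m<n⇒m<1+n)

only-solution⇒false-below : ∀ {N} {P : ℕ → Bool} → (∀ {j} → j ℕ.< suc N → P j ≡ true → j ≡ N) →
                            ∀ {j} → j ℕ.< N → P j ≡ false
only-solution⇒false-below {P = P} unique {j} j<N with P j in Pj
... | false = refl
... | true = contradiction (unique (ℕP.m<n⇒m<1+n j<N) Pj) (ℕP.<⇒≢ j<N)

firstBelow-unique : ∀ {b P N} → N ℕ.< b → P N ≡ true → (∀ {j} → j ℕ.< b → P j ≡ true → j ≡ N) →
                    firstBelow b P ≡ N
firstBelow-unique {suc b} {P} {N} N<1+b PN unique with ℕP.m≤n⇒m<n∨m≡n (ℕP.≤-pred N<1+b)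
... | inj₁ N<b rewrite anyBelow-true {P = P} N<b PN = firstBelow-unique N<b PN (unique ∘ ℕP.m<n⇒m<1+n)
... | inj₂ refl rewrite anyBelow-false {P = P} (only-solution⇒false-below unique) | PN = refl

does-true⇒ : ∀ {A : Set} (a? : Dec A) → does a? ≡ true → A
does-true⇒ (yes a) _ = a

-- residue m q is solveMod m (↧ q) (↥ q) by definition.
solveMod : ℕ → ℤ → ℤ → ℕ
solveMod m a b = firstBelow m (λ N → does (m ℕD.∣? ∣ a * + N - b ∣))

solveMod-unique : ∀ {m a b N} → Invertible m a → N ℕ.< m → a * + N ≡ b mod m → solveMod m a b ≡ N
solveMod-unique {m} {a} {b} {N} inv N<m aN≡b =
  firstBelow-unique N<m (dec-true (m ℕD.∣? _) (∣⇒∣ᵤ (∣-diff aN≡b))) unique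
  where
  unique : ∀ {j} → j ℕ.< m → does (m ℕD.∣? ∣ a * + j - b ∣) ≡ true → j ≡ N
  unique {j} j<m sol = ≡-mod⇒≡ j<m N<m (cancel-mod inv aj≡aN)
    where
    aj≡aN : a * + j ≡ a * + N mod m
    aj≡aN = ≡-mod-trans (≡-mod (∣ᵤ⇒∣ (does-true⇒ (m ℕD.∣? _) sol))) (≡-mod-sym aN≡b)

solveMod-spec : ∀ {m a} .{{_ : NonZero m}} → Invertible m a →
                ∀ b → solveMod m a b ℕ.< m × a * + solveMod m a b ≡ b mod m
solveMod-spec {m} {a} inv b with invertible⇒solvable inv b
... | N , N<m , aN≡b =
  subst (λ n → n ℕ.< m × a * + n ≡ b mod m) (sym (solveMod-unique inv N<m aN≡b)) (N<m , aN≡b)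

-- Rationals written over a given denominator

infix 4 _≃_/_
record _≃_/_ (q : ℚ) (X : ℤ) (D : ℕ) : Set where
  constructor mk≃
  field cross : ↥ q * + D ≡ X * ↧ q

≃-self : ∀ q → q ≃ ↥ q / ↧ₙ q
≃-self q = mk≃ refl

toℚᵘ-≃⇒≃ : ∀ {q u X D} → toℚᵘ q ℚᵘ.≃ u → ↥ᵘ u * + D ≡ X * ↧ᵘ u → q ≃ X / D
toℚᵘ-≃⇒≃ {mkℚ a b _} {mkℚᵘ c d} {X} {D} (ℚᵘ.*≡* ad≡cb) cD≡Xd =
  mk≃ (ℤP.*-cancelʳ-≡ _ _ (+ suc d) (begin
    a * + D * + suc d      ≡⟨ swap a (+ D) (+ suc d) ⟩
    a * + suc d * + D      ≡⟨ cong (_* + D) ad≡cb ⟩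
    c * + suc b * + D      ≡⟨ swap c (+ suc b) (+ D) ⟩
    c * + D * + suc b      ≡⟨ cong (_* + suc b) cD≡Xd ⟩
    X * + suc d * + suc b  ≡⟨ swap X (+ suc d) (+ suc b) ⟩
    X * + suc b * + suc d  ∎))
  where
  open ≡-Reasoning
  swap : ∀ x y z → x * y * z ≡ x * z * y
  swap = solve-∀

≃-resp-ratio : ∀ {q X D X′ D′} .{{_ : NonZero D}} → q ≃ X / D → X * + D′ ≡ X′ * + D → q ≃ X′ / D′
≃-resp-ratio {q} {X} {D} {X′} {D′} (mk≃ q≃X/D) XD′≡X′D = mk≃ (ℤP.*-cancelʳ-≡ _ _ (+ D) (begin
  ↥ q * + D′ * + D   ≡⟨ swap (↥ q) (+ D′) (+ D) ⟩
  ↥ q * + D * + D′   ≡⟨ cong (_* + D′) q≃X/D ⟩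
  X * ↧ q * + D′     ≡⟨ swap X (↧ q) (+ D′) ⟩
  X * + D′ * ↧ q     ≡⟨ cong (_* ↧ q) XD′≡X′D ⟩
  X′ * + D * ↧ q     ≡⟨ swap X′ (+ D) (↧ q) ⟩
  X′ * ↧ q * + D     ∎))
  where
  open ≡-Reasoning
  swap : ∀ x y z → x * y * z ≡ x * z * y
  swap = solve-∀

÷ℕ-≃ : ∀ a D .{{_ : NonZero D}} → (a ÷ℕ D) ≃ a / D
÷ℕ-≃ a (suc b) = toℚᵘ-≃⇒≃ (ℚP.toℚᵘ-fromℚᵘ (mkℚᵘ a b)) refl

≃-scale : ∀ {q X D D′} .{{_ : NonZero D}} → q ≃ X / D → ∀ K → D′ ≡ K ℕ.* D → q ≃ (X * + K) / D′
≃-scale {q} {X} {D} q≃X/D K refl = ≃-resp-ratio q≃X/D (begin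
  X * + (K ℕ.* D)    ≡⟨ cong (X *_) (ℤP.pos-* K D) ⟩
  X * (+ K * + D)    ≡⟨ ℤP.*-assoc X (+ K) (+ D) ⟨
  X * + K * + D      ∎)
  where open ≡-Reasoning

+-≃ : ∀ {q r X Y Dq Dr} → q ≃ X / Dq → r ≃ Y / Dr → (q ℚ.+ r) ≃ (X * + Dr + Y * + Dq) / (Dq ℕ.* Dr)
+-≃ {q@(mkℚ a b _)} {r@(mkℚ c d _)} {X} {Y} {Dq} {Dr} (mk≃ aDq≡Xb) (mk≃ cDr≡Yd) =
  toℚᵘ-≃⇒≃ (ℚP.toℚᵘ-homo-+ q r) (begin
    (a * + suc d + c * + suc b) * + (Dq ℕ.* Dr)
      ≡⟨ cong (_*_ (a * + suc d + c * + suc b)) (ℤP.pos-* Dq Dr) ⟩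
    (a * + suc d + c * + suc b) * (+ Dq * + Dr)
      ≡⟨ expand a (+ suc d) c (+ suc b) (+ Dq) (+ Dr) ⟩
    (a * + Dq) * (+ suc d * + Dr) + (c * + Dr) * (+ suc b * + Dq)
      ≡⟨ cong₂ (λ s t → s * (+ suc d * + Dr) + t * (+ suc b * + Dq)) aDq≡Xb cDr≡Yd ⟩
    (X * + suc b) * (+ suc d * + Dr) + (Y * + suc d) * (+ suc b * + Dq)
      ≡⟨ collect X (+ suc b) (+ suc d) (+ Dr) Y (+ Dq) ⟩
    (X * + Dr + Y * + Dq) * (+ suc b * + suc d)
      ≡⟨ cong (_*_ (X * + Dr + Y * + Dq)) (ℤP.pos-* (suc b) (suc d)) ⟨
    (X * + Dr + Y * + Dq) * + (suc b ℕ.* suc d) ∎)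
  where
  open ≡-Reasoning
  expand : ∀ a d c b Dq Dr → (a * d + c * b) * (Dq * Dr) ≡ (a * Dq) * (d * Dr) + (c * Dr) * (b * Dq)
  expand = solve-∀
  collect : ∀ X b d Dr Y Dq → (X * b) * (d * Dr) + (Y * d) * (b * Dq) ≡ (X * Dr + Y * Dq) * (b * d)
  collect = solve-∀

neg-≃ : ∀ {q X D} → q ≃ X / D → (ℚ.- q) ≃ (- X) / D
neg-≃ {q@(mkℚ a b _)} {X} {D} (mk≃ aD≡Xb) = toℚᵘ-≃⇒≃ (ℚP.toℚᵘ-homo‿- q) (begin
  - a * + D        ≡⟨ ℤP.neg-distribˡ-* a (+ D) ⟨
  - (a * + D)      ≡⟨ cong -_ aD≡Xb ⟩
  - (X * + suc b)  ≡⟨ ℤP.neg-distribˡ-* X (+ suc b) ⟩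
  - X * + suc b    ∎)
  where open ≡-Reasoning

frac-≃-% : ∀ q → frac q ≃ + (↥ q ℤ.% ↧ q) / ↧ₙ q
frac-≃-% q@(mkℚ a b _) =
  ≃-resp-ratio (+-≃ (≃-self q) (neg-≃ (÷ℕ-≃ F 1))) (begin
    (a * + 1 + - F * + B) * + B              ≡⟨ cong (λ t → (t * + 1 + - F * + B) * + B) a≡r+FB ⟩
    ((r + F * + B) * + 1 + - F * + B) * + B  ≡⟨ cancel r F (+ B) ⟩
    r * + B                                  ≡⟨ cong (λ n → r * + n) (ℕP.*-identityʳ B) ⟨
    r * + (B ℕ.* 1)                          ∎)
  where
  open ≡-Reasoning
  B = suc b
  F = ℚ.floor q
  r = + (a ℤ.% + B)
  a≡r+FB : a ≡ r + F * + B
  a≡r+FB = ℤDM.a≡a%n+[a/n]*n a (+ B)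
  cancel : ∀ r F B → ((r + F * B) * + 1 + - F * B) * B ≡ r * B
  cancel = solve-∀

*-suc≡+⇒≥0 : ∀ c {b n} → c * + suc b ≡ + n → ∃[ c′ ] c ≡ + c′
*-suc≡+⇒≥0 (+ c) _ = c , refl

frac-numerator : ∀ {q X D} → q ≃ X / D → (X - ℚ.floor q * + D) * ↧ q ≡ + ((↥ q ℤ.% ↧ q) ℕ.* D)
frac-numerator {q@(mkℚ a b _)} {X} {D} (mk≃ aD≡XB) = begin
  (X - F * + D) * + B              ≡⟨ expand X F (+ D) (+ B) ⟩
  X * + B - F * + B * + D          ≡⟨ cong (λ t → t - F * + B * + D) aD≡XB ⟨
  a * + D - F * + B * + D          ≡⟨ factor a F (+ B) (+ D) ⟩
  (a - F * + B) * + D              ≡⟨ cong (λ t → (t - F * + B) * + D) (ℤDM.a≡a%n+[a/n]*n a (+ B)) ⟩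
  (+ r + F * + B - F * + B) * + D  ≡⟨ cancel (+ r) F (+ B) (+ D) ⟩
  + r * + D                        ≡⟨ ℤP.pos-* r D ⟨
  + (r ℕ.* D)                      ∎
  where
  open ≡-Reasoning
  B = suc b
  F = ℚ.floor q
  r = a ℤ.% + B
  expand : ∀ X F D B → (X - F * D) * B ≡ X * B - F * B * D
  expand = solve-∀
  factor : ∀ a F B D → a * D - F * B * D ≡ (a - F * B) * D
  factor = solve-∀
  cancel : ∀ r F B D → (r + F * B - F * B) * D ≡ r * D
  cancel = solve-∀

-- The numerator of frac q over D is X − ⌊q⌋ D.
frac-≃ : ∀ {q X D} .{{_ : NonZero D}} → q ≃ X / D → ∃[ c ] c ℕ.< D × X ≡ + c mod D × frac q ≃ + c / D
frac-≃ {q@(mkℚ a b _)} {X} {D} q≃X/D with *-suc≡+⇒≥0 (X - ℚ.floor q * + D) (frac-numerator q≃X/D)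
... | c , c′≡c = c , c<D , X≡c , ≃-resp-ratio (frac-≃-% q) rD≡cB
  where
  B = suc b
  r = a ℤ.% + B
  cB≡rD : c ℕ.* B ≡ r ℕ.* D
  cB≡rD = ℤP.+-injective (trans (ℤP.pos-* c B) (trans (cong (_* + B) (sym c′≡c)) (frac-numerator q≃X/D)))
  c<D : c ℕ.< D
  c<D = ℕP.*-cancelʳ-< B c D (subst (ℕ._< D ℕ.* B) (sym cB≡rD)
          (subst (r ℕ.* D ℕ.<_) (ℕP.*-comm B D) (ℕP.*-monoˡ-< D (ℤDM.n%d<d a (+ B)))))
  X≡c : X ≡ + c mod D
  X≡c = ≡-mod (divides (ℚ.floor q) (trans (cong (_-_ X) (sym c′≡c)) (cancel X (ℚ.floor q * + D))))
    where
    cancel : ∀ X Y → X - (X - Y) ≡ Y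
    cancel = solve-∀
  rD≡cB : + r * + D ≡ + c * + B
  rD≡cB = trans (sym (ℤP.pos-* r D)) (trans (cong +_ (sym cB≡rD)) (ℤP.pos-* c B))

module _ {p : ℕ} (p-prime : Prime p) where

  private instance
    p≢0 : NonZero p
    p≢0 = prime⇒nonZero p-prime

  ≃-∤-denominator : ∀ {q X D} → q ≃ X / D → ¬ p ∣ℕ D → ¬ p ∣ℕ ↧ₙ q
  ≃-∤-denominator {q@(mkℚ _ _ coprime)} {X} {D} (mk≃ cross) p∤D p∣↧q
    with euclidsLemma ∣ ↥ q ∣ D p-prime p∣∣↥q∣D
    where
    p∣∣↥q∣D : p ∣ℕ ∣ ↥ q ∣ ℕ.* D
    p∣∣↥q∣D = subst (p ∣ℕ_) (ℤP.abs-* (↥ q) (+ D))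
                (∣⇒∣ᵤ (subst (+ p ∣_) (sym cross) (∣n⇒∣m*n X (∣ᵤ⇒∣ p∣↧q))))
  ... | inj₁ p∣↥q =
    ℕ.nonTrivial⇒≢1 {{prime⇒nonTrivial p-prime}} (Coprimality.recompute coprime (p∣↥q , p∣↧q))
  ... | inj₂ p∣D = p∤D p∣D

  residue-≃ : ∀ {q X D} k → q ≃ X / D → ¬ p ∣ℕ D →
              residue (p ℕ.^ k) q ℕ.< p ℕ.^ k × + D * + residue (p ℕ.^ k) q ≡ X mod p ℕ.^ k
  residue-≃ {q} {X} {D} k q≃X/D@(mk≃ cross) p∤D =
    proj₁ spec , cancel-mod (∤⇒invertible-mod-prime^ p-prime ↧q-unit k) (begin
      ↧ q * (+ D * + N)  ≡⟨ swap (↧ q) (+ D) (+ N) ⟩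
      + D * (↧ q * + N)  ≈⟨ *-congˡ-mod (+ D) (proj₂ spec) ⟩
      + D * ↥ q          ≡⟨ ℤP.*-comm (+ D) (↥ q) ⟩
      ↥ q * + D          ≡⟨ cross ⟩
      X * ↧ q            ≡⟨ ℤP.*-comm X (↧ q) ⟩
      ↧ q * X            ∎)
    where
    open ≡-mod-Reasoning (p ℕ.^ k)
    instance
      p^k≢0 : NonZero (p ℕ.^ k)
      p^k≢0 = ℕP.m^n≢0 p k
    N = residue (p ℕ.^ k) q
    ↧q-unit = ≃-∤-denominator q≃X/D p∤D
    spec = solveMod-spec (∤⇒invertible-mod-prime^ p-prime ↧q-unit k) (↥ q)
    swap : ∀ a b c → a * (b * c) ≡ b * (a * c)
    swap = solve-∀

-1^[1+n]≡-1⇒-1^n≡1 : ∀ {n} → -1ℤ ^ suc n ≡ -1ℤ → -1ℤ ^ n ≡ + 1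
-1^[1+n]≡-1⇒-1^n≡1 {n} odd = ℤP.neg-injective (trans (sym (ℤP.-1*i≡-i (-1ℤ ^ n))) odd)

-1^[h+h]≡1 : ∀ h → -1ℤ ^ (h ℕ.+ h) ≡ + 1
-1^[h+h]≡1 zero = refl
-1^[h+h]≡1 (suc h) =
  trans (cong (λ n → -1ℤ ^ suc n) (ℕP.+-suc h h)) (cong (λ x → -1ℤ * (-1ℤ * x)) (-1^[h+h]≡1 h))

-1^[n^k]≡-1 : ∀ {n} → -1ℤ ^ n ≡ -1ℤ → ∀ k → -1ℤ ^ (n ℕ.^ k) ≡ -1ℤ
-1^[n^k]≡-1 n-odd zero = refl
-1^[n^k]≡-1 {n} n-odd (suc k) = begin
  -1ℤ ^ (n ℕ.* n ℕ.^ k)  ≡⟨ ℤP.^-*-assoc -1ℤ n (n ℕ.^ k) ⟨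
  (-1ℤ ^ n) ^ (n ℕ.^ k)  ≡⟨ cong (_^ (n ℕ.^ k)) n-odd ⟩
  -1ℤ ^ (n ℕ.^ k)        ≡⟨ -1^[n^k]≡-1 n-odd k ⟩
  -1ℤ                    ∎
  where open ≡-Reasoning

-1^a*-1^b≡1⇒-1^a≡-1^b : ∀ {a b} → -1ℤ ^ a * -1ℤ ^ b ≡ + 1 → -1ℤ ^ a ≡ -1ℤ ^ b
-1^a*-1^b≡1⇒-1^a≡-1^b {a} {b} product≡1 = begin
  -1ℤ ^ a                          ≡⟨ ℤP.*-identityʳ (-1ℤ ^ a) ⟨
  -1ℤ ^ a * + 1                    ≡⟨ cong (-1ℤ ^ a *_) (trans (sym (ℤP.^-distribˡ-+-* -1ℤ b b)) (-1^[h+h]≡1 b)) ⟨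
  -1ℤ ^ a * (-1ℤ ^ b * -1ℤ ^ b)    ≡⟨ ℤP.*-assoc (-1ℤ ^ a) (-1ℤ ^ b) (-1ℤ ^ b) ⟨
  -1ℤ ^ a * -1ℤ ^ b * -1ℤ ^ b      ≡⟨ cong (_* -1ℤ ^ b) product≡1 ⟩
  + 1 * -1ℤ ^ b                    ≡⟨ ℤP.*-identityˡ (-1ℤ ^ b) ⟩
  -1ℤ ^ b                          ∎
  where open ≡-Reasoning

2∣n⇒-1^n≡1 : ∀ {n} → 2 ∣ℕ n → -1ℤ ^ n ≡ + 1
2∣n⇒-1^n≡1 (ℕD.divides q refl) =
  trans (cong (-1ℤ ^_) (ℕP.*-comm q 2)) (trans (sym (ℤP.^-*-assoc -1ℤ 2 q)) (ℤP.^-zeroˡ q))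

parity : ∀ n → ∃[ h ] (n ≡ h ℕ.+ h ⊎ n ≡ suc (h ℕ.+ h))
parity zero = 0 , inj₁ refl
parity (suc n) with parity n
... | h , inj₁ n≡h+h = h , inj₂ (cong suc n≡h+h)
... | h , inj₂ n≡1+h+h = suc h , inj₁ (cong suc (trans n≡1+h+h (sym (ℕP.+-suc h h))))

prime≢2⇒odd : ∀ {p} → Prime p → p ≢ 2 → ∃[ h ] p ≡ suc (h ℕ.+ h)
prime≢2⇒odd {p} p-prime p≢2 with parity p
... | h , inj₂ p≡1+h+h = h , p≡1+h+h
... | h , inj₁ p≡h+h with prime⇒irreducible p-prime 2∣p
  where
  2∣p : 2 ∣ℕ p
  2∣p = ℕD.divides h (trans p≡h+h (trans (cong (h ℕ.+_) (sym (ℕP.+-identityʳ h))) (ℕP.*-comm 2 h)))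
...   | inj₂ 2≡p = contradiction (sym 2≡p) p≢2

prime≢2⇒-1^p≡-1 : ∀ {p} → Prime p → p ≢ 2 → -1ℤ ^ p ≡ -1ℤ
prime≢2⇒-1^p≡-1 p-prime p≢2 with prime≢2⇒odd p-prime p≢2
... | h , refl = cong (-1ℤ *_) (-1^[h+h]≡1 h)

-1^a*-1^[1+b]≡1 : ∀ {a b m} → -1ℤ ^ m ≡ -1ℤ → a ℕ.+ b ≡ m → -1ℤ ^ a * -1ℤ ^ suc b ≡ + 1
-1^a*-1^[1+b]≡1 {a} {b} {m} m-odd a+b≡m = begin
  -1ℤ ^ a * -1ℤ ^ suc b   ≡⟨ ℤP.^-distribˡ-+-* -1ℤ a (suc b) ⟨
  -1ℤ ^ (a ℕ.+ suc b)     ≡⟨ cong (-1ℤ ^_) (trans (ℕP.+-suc a b) (cong suc a+b≡m)) ⟩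
  -1ℤ * -1ℤ ^ m           ≡⟨ cong (-1ℤ *_) m-odd ⟩
  + 1                     ∎
  where open ≡-Reasoning

-- Morita's Γ_p on the naturals

module _ (p : ℕ) where

  unitPart : ℕ → ℤ
  unitPart j = if does (p ℕD.∣? j) then + 1 else + j

  unitSign : ℕ → ℤ
  unitSign j = if does (p ℕD.∣? j) then + 1 else -1ℤ

  unitProduct : ℕ → ℕ → ℤ
  unitProduct a zero = + 1
  unitProduct a (suc t) = unitProduct a t * unitPart (a ℕ.+ t)

  signProduct : ℕ → ℤ
  signProduct zero = + 1
  signProduct (suc t) = signProduct t * unitSign (suc t)

  module _ {j : ℕ} where

    unitPart-∣ : p ∣ℕ j → unitPart j ≡ + 1
    unitPart-∣ p∣j rewrite dec-true (p ℕD.∣? j) p∣j = refl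

    unitPart-∤ : ¬ p ∣ℕ j → unitPart j ≡ + j
    unitPart-∤ p∤j rewrite dec-false (p ℕD.∣? j) p∤j = refl

    unitSign-∣ : p ∣ℕ j → unitSign j ≡ + 1
    unitSign-∣ p∣j rewrite dec-true (p ℕD.∣? j) p∣j = refl

    unitSign-∤ : ¬ p ∣ℕ j → unitSign j ≡ -1ℤ
    unitSign-∤ p∤j rewrite dec-false (p ℕD.∣? j) p∤j = refl

  ΓpNat≡±unitProduct : ∀ N → ΓpNat p N ≡ -1ℤ ^ N * unitProduct 0 N
  ΓpNat≡±unitProduct zero = refl
  ΓpNat≡±unitProduct (suc N) = begin
    - (ΓpNat p N * unitPart N)                       ≡⟨ cong (λ Γ → - (Γ * unitPart N)) (ΓpNat≡±unitProduct N) ⟩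
    - (-1ℤ ^ N * unitProduct 0 N * unitPart N)       ≡⟨ regroup (-1ℤ ^ N) (unitProduct 0 N) (unitPart N) ⟩
    - + 1 * -1ℤ ^ N * (unitProduct 0 N * unitPart N) ∎
    where
    open ≡-Reasoning
    regroup : ∀ s u f → - (s * u * f) ≡ - + 1 * s * (u * f)
    regroup = solve-∀

  unitProduct-+ : ∀ a s t → unitProduct a (s ℕ.+ t) ≡ unitProduct a s * unitProduct (a ℕ.+ s) t
  unitProduct-+ a s zero = trans (cong (unitProduct a) (ℕP.+-identityʳ s)) (sym (ℤP.*-identityʳ _))
  unitProduct-+ a s (suc t) = begin
    unitProduct a (s ℕ.+ suc t)
      ≡⟨ cong (unitProduct a) (ℕP.+-suc s t) ⟩
    unitProduct a (s ℕ.+ t) * unitPart (a ℕ.+ (s ℕ.+ t))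
      ≡⟨ cong₂ _*_ (unitProduct-+ a s t) (cong unitPart (sym (ℕP.+-assoc a s t))) ⟩
    unitProduct a s * unitProduct (a ℕ.+ s) t * unitPart (a ℕ.+ s ℕ.+ t)
      ≡⟨ ℤP.*-assoc (unitProduct a s) _ _ ⟩
    unitProduct a s * unitProduct (a ℕ.+ s) (suc t) ∎
    where open ≡-Reasoning

  unitProduct-suc : ∀ a t → unitProduct a (suc t) ≡ unitPart a * unitProduct (suc a) t
  unitProduct-suc a t = begin
    unitProduct a (1 ℕ.+ t)
      ≡⟨ unitProduct-+ a 1 t ⟩
    unitProduct a 1 * unitProduct (a ℕ.+ 1) t
      ≡⟨ cong₂ _*_ (ℤP.*-identityˡ (unitPart (a ℕ.+ 0))) (cong (λ b → unitProduct b t) (ℕP.+-comm a 1)) ⟩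
    unitPart (a ℕ.+ 0) * unitProduct (suc a) t
      ≡⟨ cong (λ b → unitPart b * unitProduct (suc a) t) (ℕP.+-identityʳ a) ⟩
    unitPart a * unitProduct (suc a) t ∎
    where open ≡-Reasoning

  module _ {m : ℕ} (p∣m : p ∣ℕ m) where

    unitPart-reflect : ∀ {a j} → a ℕ.+ j ≡ m → unitPart j ≡ unitSign j * unitPart a mod m
    unitPart-reflect {a} {j} a+j≡m = by-cases (p ℕD.∣? j)
      where
      open ≡-Reasoning
      by-cases : Dec (p ∣ℕ j) → unitPart j ≡ unitSign j * unitPart a mod m
      by-cases (yes p∣j) = ≡-mod-reflexive (begin
        unitPart j              ≡⟨ unitPart-∣ p∣j ⟩
        + 1                     ≡⟨ cong₂ _*_ (unitSign-∣ p∣j) (unitPart-∣ p∣a) ⟨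
        unitSign j * unitPart a ∎)
        where
        p∣a : p ∣ℕ a
        p∣a = ℕD.∣m+n∣m⇒∣n (subst (p ∣ℕ_) (trans (sym a+j≡m) (ℕP.+-comm a j)) p∣m) p∣j
      by-cases (no p∤j) = ≡-mod (divides (+ 1) (begin
        unitPart j - unitSign j * unitPart a ≡⟨ cong₂ (λ u v → u - v * unitPart a) (unitPart-∤ p∤j) (unitSign-∤ p∤j) ⟩
        + j - -1ℤ * unitPart a               ≡⟨ cong (λ u → + j - -1ℤ * u) (unitPart-∤ p∤a) ⟩
        + j - -1ℤ * + a                      ≡⟨ simplify (+ j) (+ a) ⟩
        + a + + j                            ≡⟨ ℤP.pos-+ a j ⟨
        + (a ℕ.+ j)                          ≡⟨ cong +_ a+j≡m ⟩
        + m                                  ≡⟨ ℤP.*-identityˡ (+ m) ⟨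
        + 1 * + m                            ∎))
        where
        p∤a : ¬ p ∣ℕ a
        p∤a p∣a = p∤j (ℕD.∣m+n∣m⇒∣n (subst (p ∣ℕ_) (sym a+j≡m) p∣m) p∣a)
        simplify : ∀ j a → j - - + 1 * a ≡ a + j
        simplify = solve-∀

    unitProduct-reflect : ∀ t a → a ℕ.+ t ≡ m → unitProduct 1 t ≡ signProduct t * unitProduct a t mod m
    unitProduct-reflect zero a _ = ≡-mod-refl
    unitProduct-reflect (suc t) a a+1+t≡m = begin
      unitProduct 1 t * unitPart (suc t)
        ≈⟨ *-cong-mod (unitProduct-reflect t (suc a) (trans (sym (ℕP.+-suc a t)) a+1+t≡m))
                      (unitPart-reflect a+1+t≡m) ⟩
      signProduct t * unitProduct (suc a) t * (unitSign (suc t) * unitPart a)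
        ≡⟨ regroup (signProduct t) (unitProduct (suc a) t) (unitSign (suc t)) (unitPart a) ⟩
      signProduct (suc t) * (unitPart a * unitProduct (suc a) t)
        ≡⟨ cong (signProduct (suc t) *_) (unitProduct-suc a t) ⟨
      signProduct (suc t) * unitProduct a (suc t) ∎
      where
      open ≡-mod-Reasoning m
      regroup : ∀ σ R ε f → σ * R * (ε * f) ≡ σ * ε * (f * R)
      regroup = solve-∀

  Γ-reflection-sum : ∀ {m N t} → p ∣ℕ m → -1ℤ ^ m ≡ -1ℤ → N ℕ.+ t ≡ m →
                     ΓpNat p N * ΓpNat p (suc t) ≡ signProduct t * unitProduct 0 m mod m
  Γ-reflection-sum {m} {N} {t} p∣m m-odd N+t≡m = begin
    ΓpNat p N * ΓpNat p (suc t)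
      ≡⟨ cong₂ _*_ (ΓpNat≡±unitProduct N) (ΓpNat≡±unitProduct (suc t)) ⟩
    -1ℤ ^ N * unitProduct 0 N * (-1ℤ ^ suc t * unitProduct 0 (suc t))
      ≡⟨ regroup (-1ℤ ^ N) (unitProduct 0 N) (-1ℤ ^ suc t) (unitProduct 0 (suc t)) ⟩
    -1ℤ ^ N * -1ℤ ^ suc t * (unitProduct 0 N * unitProduct 0 (suc t))
      ≡⟨ cong₂ _*_ (-1^a*-1^[1+b]≡1 {N} {t} m-odd N+t≡m) (cong (unitProduct 0 N *_) R₀[1+t]≡R₁t) ⟩
    + 1 * (unitProduct 0 N * unitProduct 1 t)
      ≡⟨ ℤP.*-identityˡ _ ⟩
    unitProduct 0 N * unitProduct 1 t
      ≈⟨ *-congˡ-mod (unitProduct 0 N) (unitProduct-reflect p∣m t N N+t≡m) ⟩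
    unitProduct 0 N * (signProduct t * unitProduct N t)
      ≡⟨ swap (unitProduct 0 N) (signProduct t) (unitProduct N t) ⟩
    signProduct t * (unitProduct 0 N * unitProduct N t)
      ≡⟨ cong (signProduct t *_) (unitProduct-+ 0 N t) ⟨
    signProduct t * unitProduct 0 (N ℕ.+ t)
      ≡⟨ cong (λ n → signProduct t * unitProduct 0 n) N+t≡m ⟩
    signProduct t * unitProduct 0 m ∎
    where
    open ≡-mod-Reasoning m
    regroup : ∀ a b c d → a * b * (c * d) ≡ a * c * (b * d)
    regroup = solve-∀
    swap : ∀ a b c → a * (b * c) ≡ b * (a * c)
    swap = solve-∀
    R₀[1+t]≡R₁t : unitProduct 0 (suc t) ≡ unitProduct 1 t
    R₀[1+t]≡R₁t = trans (unitProduct-suc 0 t)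
                    (trans (cong (_* unitProduct 1 t) (unitPart-∣ (p ℕD.∣0))) (ℤP.*-identityˡ _))

  module _ .{{_ : NonZero p}} where

    residueSign : ℕ → ℤ
    residueSign c = -1ℤ ^ (c ℕ.% p)

    residueSign-cong : ∀ {a b} → + a ≡ + b mod p → residueSign a ≡ residueSign b
    residueSign-cong a≡b = cong (-1ℤ ^_) (≡-mod⇒%-≡ a≡b)

    signProduct≡residueSign : -1ℤ ^ p ≡ -1ℤ → ∀ t → signProduct t ≡ residueSign t
    signProduct≡residueSign _ zero = cong (-1ℤ ^_) (sym (ℕDM.m<n⇒m%n≡m (ℕ.>-nonZero⁻¹ p)))
    signProduct≡residueSign p-odd (suc t) with ℕP.m≤n⇒m<n∨m≡n (ℕDM.m%n<n t p)
    ... | inj₁ 1+r<p = begin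
      signProduct t * unitSign (suc t)  ≡⟨ cong₂ _*_ (signProduct≡residueSign p-odd t) (unitSign-∤ p∤1+t) ⟩
      -1ℤ ^ r * -1ℤ                     ≡⟨ ℤP.*-comm (-1ℤ ^ r) -1ℤ ⟩
      -1ℤ ^ suc r                       ≡⟨ cong (-1ℤ ^_) 1+t%p≡1+r ⟨
      -1ℤ ^ (suc t ℕ.% p)               ∎
      where
      open ≡-Reasoning
      r = t ℕ.% p
      1+t%p≡1+r : suc t ℕ.% p ≡ suc r
      1+t%p≡1+r = trans (suc-% t) (ℕDM.m<n⇒m%n≡m 1+r<p)
      p∤1+t : ¬ p ∣ℕ suc t
      p∤1+t p∣1+t = contradiction (trans (sym 1+t%p≡1+r) (ℕD.n∣m⇒m%n≡0 (suc t) p p∣1+t)) λ ()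
    ... | inj₂ 1+r≡p = begin
      signProduct t * unitSign (suc t)  ≡⟨ cong₂ _*_ (signProduct≡residueSign p-odd t) (unitSign-∣ p∣1+t) ⟩
      -1ℤ ^ r * + 1                     ≡⟨ ℤP.*-identityʳ (-1ℤ ^ r) ⟩
      -1ℤ ^ r                           ≡⟨ -1^[1+n]≡-1⇒-1^n≡1 {r} (trans (cong (-1ℤ ^_) 1+r≡p) p-odd) ⟩
      + 1                               ≡⟨ cong (-1ℤ ^_) 1+t%p≡0 ⟨
      -1ℤ ^ (suc t ℕ.% p)               ∎
      where
      open ≡-Reasoning
      r = t ℕ.% p
      1+t%p≡0 : suc t ℕ.% p ≡ 0
      1+t%p≡0 = trans (suc-% t) (trans (cong (ℕ._% p) 1+r≡p) (ℕDM.n%n≡0 p))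
      p∣1+t : p ∣ℕ suc t
      p∣1+t = ℕD.m%n≡0⇒n∣m (suc t) p 1+t%p≡0

-- Wilson's theorem modulo p^(k+1)

productOver : (ℕ → Bool) → ℕ → ℤ
productOver S zero = + 1
productOver S (suc N) = productOver S N * (if S N then + N else + 1)

productOver-cong : ∀ {S T} N → (∀ {j} → j ℕ.< N → S j ≡ T j) → productOver S N ≡ productOver T N
productOver-cong zero _ = refl
productOver-cong {S} {T} (suc N) S≗T =
  cong₂ _*_ (productOver-cong N (S≗T ∘ ℕP.m<n⇒m<1+n)) (cong (λ b → if b then + N else + 1) (S≗T (ℕP.n<1+n N)))

productOver-none : ∀ {S} N → (∀ {j} → j ℕ.< N → S j ≡ false) → productOver S N ≡ + 1
productOver-none zero _ = refl
productOver-none {S} (suc N) none rewrite none (ℕP.n<1+n N) =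
  trans (ℤP.*-identityʳ _) (productOver-none N (none ∘ ℕP.m<n⇒m<1+n))

remove : ℕ → (ℕ → Bool) → ℕ → Bool
remove x S j = S j ∧ not (does (j ℕ.≟ x))

remove-≢ : ∀ {x j} S → j ≢ x → remove x S j ≡ S j
remove-≢ {x} {j} S j≢x rewrite dec-false (j ℕ.≟ x) j≢x = ∧-identityʳ (S j)

remove-self : ∀ x S → remove x S x ≡ false
remove-self x S rewrite dec-true (x ℕ.≟ x) refl = ∧-zeroʳ (S x)

remove-true : ∀ {x j} S → remove x S j ≡ true → S j ≡ true × j ≢ x
remove-true {x} {j} S removed with j ℕ.≟ x
... | yes refl = contradiction (trans (sym removed) (remove-self x S)) λ ()
... | no j≢x = trans (sym (remove-≢ S j≢x)) removed , j≢x

productOver-remove : ∀ {S x} N → x ℕ.< N → S x ≡ true → productOver S N ≡ + x * productOver (remove x S) N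
productOver-remove {S} {x} (suc N) x<1+N Sx with ℕP.m≤n⇒m<n∨m≡n (ℕP.≤-pred x<1+N)
... | inj₁ x<N = begin
  productOver S N * factor (S N)           ≡⟨ cong (_* factor (S N)) (productOver-remove N x<N Sx) ⟩
  + x * productOver S′ N * factor (S N)    ≡⟨ ℤP.*-assoc (+ x) _ _ ⟩
  + x * (productOver S′ N * factor (S N))
    ≡⟨ cong (λ b → + x * (productOver S′ N * factor b)) (remove-≢ S (ℕP.>⇒≢ x<N)) ⟨
  + x * productOver S′ (suc N)             ∎
  where
  open ≡-Reasoning
  S′ = remove x S
  factor : Bool → ℤ
  factor b = if b then + N else + 1
... | inj₂ refl = begin
  productOver S x * factor (S x)    ≡⟨ cong (λ b → productOver S x * factor b) Sx ⟩
  productOver S x * + x             ≡⟨ ℤP.*-comm (productOver S x) (+ x) ⟩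
  + x * productOver S x             ≡⟨ cong (+ x *_) (productOver-cong x (λ j<x → sym (remove-≢ S (ℕP.<⇒≢ j<x)))) ⟩
  + x * productOver S′ x            ≡⟨ cong (+ x *_) (ℤP.*-identityʳ _) ⟨
  + x * (productOver S′ x * + 1)    ≡⟨ cong (λ b → + x * (productOver S′ x * factor b)) (remove-self x S) ⟨
  + x * productOver S′ (suc x)      ∎
  where
  open ≡-Reasoning
  S′ = remove x S
  factor : Bool → ℤ
  factor b = if b then + x else + 1

∧-true⇒ : ∀ a {b} → a ∧ b ≡ true → a ≡ true × b ≡ true
∧-true⇒ true b≡true = refl , b≡true

fixedPoints : (ℕ → ℕ) → (ℕ → Bool) → ℕ → Bool
fixedPoints ι S j = S j ∧ does (ι j ℕ.≟ j)

ClosedBelow : (ℕ → Set) → (ℕ → ℕ) → ℕ → (ℕ → Bool) → Set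
ClosedBelow U ι N S = ∀ {j} → j ℕ.< N → S j ≡ true → U j × ι j ℕ.< N × S (ι j) ≡ true

module _ {m : ℕ} {U : ℕ → Set} (ι : ℕ → ℕ)
         (ι-involutive : ∀ {j} → U j → ι (ι j) ≡ j)
         (ι-inverse : ∀ {j} → U j → + j * + ι j ≡ + 1 mod m) where

  private
    <1+n∧≢n⇒<n : ∀ {j N} → j ℕ.< suc N → j ≢ N → j ℕ.< N
    <1+n∧≢n⇒<n j<1+N j≢N = ℕP.≤∧≢⇒< (ℕP.≤-pred j<1+N) j≢N

    shrink : ∀ {N S} → ClosedBelow U ι (suc N) S → (∀ {j} → j ℕ.< N → S j ≡ true → ι j ≢ N) →
             ClosedBelow U ι N S
    shrink closed ι≢N j<N Sj with closed (ℕP.m<n⇒m<1+n j<N) Sj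
    ... | Uj , ιj<1+N , Sιj = Uj , <1+n∧≢n⇒<n ιj<1+N (ι≢N j<N Sj) , Sιj

    module WithoutPartner {N S} (closed : ClosedBelow U ι (suc N) S) (SN : S N ≡ true) (ιN≢N : ι N ≢ N) where

      UN : U N
      UN = proj₁ (closed (ℕP.n<1+n N) SN)

      S[ιN] : S (ι N) ≡ true
      S[ιN] = proj₂ (proj₂ (closed (ℕP.n<1+n N) SN))

      ιN<N : ι N ℕ.< N
      ιN<N = <1+n∧≢n⇒<n (proj₁ (proj₂ (closed (ℕP.n<1+n N) SN))) ιN≢N

      closed-without : ClosedBelow U ι N (remove (ι N) S)
      closed-without {j} j<N S′j with remove-true S S′j
      ... | Sj , j≢ιN with closed (ℕP.m<n⇒m<1+n j<N) Sj
      ... | Uj , ιj<1+N , Sιj = Uj , <1+n∧≢n⇒<n ιj<1+N ιj≢N , trans (remove-≢ S ιj≢ιN) Sιj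
        where
        ιj≢N : ι j ≢ N
        ιj≢N ιj≡N = j≢ιN (trans (sym (ι-involutive Uj)) (cong ι ιj≡N))
        ιj≢ιN : ι j ≢ ι N
        ιj≢ιN ιj≡ιN =
          ℕP.<⇒≢ j<N (trans (sym (ι-involutive Uj)) (trans (cong ι ιj≡ιN) (ι-involutive UN)))

      fixedPoints-without : ∀ {j} → j ℕ.< N → fixedPoints ι (remove (ι N) S) j ≡ fixedPoints ι S j
      fixedPoints-without {j} j<N with j ℕ.≟ ι N
      ... | no j≢ιN = cong (_∧ does (ι j ℕ.≟ j)) (remove-≢ S j≢ιN)
      ... | yes refl = trans (cong (_∧ does (ι (ι N) ℕ.≟ ι N)) (remove-self (ι N) S))
        (sym (trans (cong (S (ι N) ∧_) (dec-false (ι (ι N) ℕ.≟ ι N) ιιN≢ιN)) (∧-zeroʳ (S (ι N)))))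
        where
        ιιN≢ιN : ι (ι N) ≢ ι N
        ιιN≢ιN ιιN≡ιN = ιN≢N (trans (sym ιιN≡ιN) (ι-involutive UN))

  productOver-pairing : ∀ N S → ClosedBelow U ι N S → productOver S N ≡ productOver (fixedPoints ι S) N mod m
  productOver-pairing zero S closed = ≡-mod-refl
  productOver-pairing (suc N) S closed with S N in SN | ι N ℕ.≟ N
  ... | false | _ = *-cong-mod (productOver-pairing N S (shrink closed ιj≢N)) ≡-mod-refl
    where
    ιj≢N : ∀ {j} → j ℕ.< N → S j ≡ true → ι j ≢ N
    ιj≢N j<N Sj ιj≡N = contradiction
      (trans (sym SN) (subst (λ i → S i ≡ true) ιj≡N (proj₂ (proj₂ (closed (ℕP.m<n⇒m<1+n j<N) Sj))))) λ ()
  ... | true | yes ιN≡N = *-cong-mod (productOver-pairing N S (shrink closed ιj≢N))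
    (≡-mod-reflexive (cong (λ b → if b then + N else + 1) (sym (dec-true (ι N ℕ.≟ N) ιN≡N))))
    where
    ιj≢N : ∀ {j} → j ℕ.< N → S j ≡ true → ι j ≢ N
    ιj≢N {j} j<N Sj ιj≡N = ℕP.<⇒≢ j<N
      (trans (sym (ι-involutive (proj₁ (closed (ℕP.m<n⇒m<1+n j<N) Sj)))) (trans (cong ι ιj≡N) ιN≡N))
  ... | true | no ιN≢N = begin
    productOver S N * + N                         ≡⟨ cong (_* + N) (productOver-remove N ιN<N S[ιN]) ⟩
    + ι N * productOver S′ N * + N                ≡⟨ regroup (+ ι N) (productOver S′ N) (+ N) ⟩
    productOver S′ N * (+ N * + ι N)              ≈⟨ *-congˡ-mod (productOver S′ N) (ι-inverse UN) ⟩
    productOver S′ N * + 1                        ≈⟨ *-congʳ-mod (+ 1) (productOver-pairing N S′ closed-without) ⟩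
    productOver (fixedPoints ι S′) N * + 1
      ≡⟨ cong₂ _*_ (productOver-cong N fixedPoints-without)
                   (cong (λ b → if b then + N else + 1) (sym (dec-false (ι N ℕ.≟ N) ιN≢N))) ⟩
    productOver (fixedPoints ι S) N * (if does (ι N ℕ.≟ N) then + N else + 1) ∎
    where
    open ≡-mod-Reasoning m
    open WithoutPartner closed SN ιN≢N
    S′ = remove (ι N) S
    regroup : ∀ y P N → y * P * N ≡ P * (N * y)
    regroup = solve-∀

module Wilson {p : ℕ} (p-prime : Prime p) (p≢2 : p ≢ 2) (k : ℕ) where

  private
    m : ℕ
    m = p ℕ.^ suc k

    m′ : ℕ
    m′ = ℕ.pred m

    instance
      p≢0 : NonZero p
      p≢0 = prime⇒nonZero p-prime
      m≢0 : NonZero m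
      m≢0 = ℕP.m^n≢0 p (suc k)

    p∣m : p ∣ℕ m
    p∣m = ℕD.∣m⇒∣m*n (p ℕ.^ k) ℕD.∣-refl

    2<p : 2 ℕ.< p
    2<p = ℕP.≤∧≢⇒< (ℕ.nonTrivial⇒n>1 p {{prime⇒nonTrivial p-prime}}) (p≢2 ∘ sym)

    1+m′≡m : suc m′ ≡ m
    1+m′≡m = ℕP.suc-pred m

    m′<m : m′ ℕ.< m
    m′<m = subst (m′ ℕ.<_) 1+m′≡m (ℕP.n<1+n m′)

    1<m′ : 1 ℕ.< m′
    1<m′ = ℕP.≤-pred (subst (2 ℕ.<_) (sym 1+m′≡m) (ℕP.<-≤-trans 2<p (ℕD.∣⇒≤ p∣m)))

    p∤1 : ¬ p ∣ℕ 1
    p∤1 p∣1 = ℕ.nonTrivial⇒≢1 {{prime⇒nonTrivial p-prime}} (ℕD.∣1⇒≡1 p∣1)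

    p∤m′ : ¬ p ∣ℕ m′
    p∤m′ p∣m′ = p∤1 (ℕD.∣m+n∣m⇒∣n (subst (p ∣ℕ_) (trans (sym 1+m′≡m) (ℕP.+-comm 1 m′)) p∣m) p∣m′)

    m≡0 : + m ≡ + 0 mod m
    m≡0 = ∣⇒≡0-mod ∣-refl

    m′≡-1 : + m′ ≡ -1ℤ mod m
    m′≡-1 = begin
      + m′               ≡⟨ cancel (+ m′) ⟨
      + 1 + + m′ - + 1   ≡⟨ cong (_- + 1) (trans (sym (ℤP.pos-+ 1 m′)) (cong +_ 1+m′≡m)) ⟩
      + m - + 1          ≈⟨ +-cong-mod m≡0 (≡-mod-refl {a = - + 1}) ⟩
      + 0 - + 1          ∎
      where
      open ≡-mod-Reasoning m
      cancel : ∀ x → + 1 + x - + 1 ≡ x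
      cancel = solve-∀

    unitInverse : ∀ {j} → ¬ p ∣ℕ j → Invertible m (+ j)
    unitInverse p∤j = ∤⇒invertible-mod-prime^ p-prime p∤j (suc k)

    isUnit : ℕ → Bool
    isUnit j = not (does (p ℕD.∣? j))

    unitProduct≡productOver-isUnit : ∀ N → unitProduct p 0 N ≡ productOver isUnit N
    unitProduct≡productOver-isUnit zero = refl
    unitProduct≡productOver-isUnit (suc N) =
      cong₂ _*_ (unitProduct≡productOver-isUnit N) (if-not (does (p ℕD.∣? N)))
      where
      if-not : ∀ b → (if b then + 1 else + N) ≡ (if not b then + N else + 1)
      if-not true = refl
      if-not false = refl

    isUnit⇒∤ : ∀ {j} → isUnit j ≡ true → ¬ p ∣ℕ j
    isUnit⇒∤ {j} unit p∣j rewrite dec-true (p ℕD.∣? j) p∣j = contradiction unit λ ()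

    ∤⇒isUnit : ∀ {j} → ¬ p ∣ℕ j → isUnit j ≡ true
    ∤⇒isUnit {j} p∤j rewrite dec-false (p ℕD.∣? j) p∤j = refl

    ι : ℕ → ℕ
    ι j = solveMod m (+ j) (+ 1)

    ι-spec : ∀ {j} → ¬ p ∣ℕ j → ι j ℕ.< m × + j * + ι j ≡ + 1 mod m
    ι-spec p∤j = solveMod-spec (unitInverse p∤j) (+ 1)

    ι-∤ : ∀ {j} → ¬ p ∣ℕ j → ¬ p ∣ℕ ι j
    ι-∤ {j} p∤j p∣ιj = p∤1 (∣⇒∣ᵤ (≡0-mod⇒∣ (begin
      + 1            ≈⟨ ≡-mod-∣ p∣m (proj₂ (ι-spec p∤j)) ⟨
      + j * + ι j    ≈⟨ *-congˡ-mod (+ j) (∣⇒≡0-mod (∣ᵤ⇒∣ p∣ιj)) ⟩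
      + j * + 0      ≡⟨ ℤP.*-zeroʳ (+ j) ⟩
      + 0            ∎)))
      where
      open ≡-mod-Reasoning p

    Unit : ℕ → Set
    Unit j = j ℕ.< m × ¬ p ∣ℕ j

    ι-involutive : ∀ {j} → Unit j → ι (ι j) ≡ j
    ι-involutive {j} (j<m , p∤j) = solveMod-unique (unitInverse (ι-∤ p∤j)) j<m
      (≡-mod-trans (≡-mod-reflexive (ℤP.*-comm (+ ι j) (+ j))) (proj₂ (ι-spec p∤j)))

    ι-inverse : ∀ {j} → Unit j → + j * + ι j ≡ + 1 mod m
    ι-inverse (_ , p∤j) = proj₂ (ι-spec p∤j)

    units-closed : ClosedBelow Unit ι m isUnit
    units-closed j<m unit =
      (j<m , isUnit⇒∤ unit) , proj₁ (ι-spec (isUnit⇒∤ unit)) , ∤⇒isUnit (ι-∤ (isUnit⇒∤ unit))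

    [2+i]i≡0 : ∀ {i} → + suc i * + suc i ≡ + 1 mod m → + (2 ℕ.+ i) * + i ≡ + 0 mod m
    [2+i]i≡0 {i} square≡1 = begin
      + (2 ℕ.+ i) * + i                ≡⟨ cong (_* + i) (ℤP.pos-+ 2 i) ⟩
      (+ 2 + + i) * + i                ≡⟨ complete-square (+ i) ⟩
      (+ 1 + + i) * (+ 1 + + i) - + 1  ≡⟨ cong (λ t → t * t - + 1) (ℤP.pos-+ 1 i) ⟨
      + suc i * + suc i - + 1          ≈⟨ +-cong-mod square≡1 (≡-mod-refl {a = - + 1}) ⟩
      + 1 - + 1                        ∎
      where
      open ≡-mod-Reasoning m
      complete-square : ∀ i → (+ 2 + i) * i ≡ (+ 1 + i) * (+ 1 + i) - + 1
      complete-square = solve-∀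

    square≡1⇒±1 : ∀ {j} → j ℕ.< m → ¬ p ∣ℕ j → + j * + j ≡ + 1 mod m → j ≡ 1 ⊎ j ≡ m′
    square≡1⇒±1 {zero} _ p∤0 _ = contradiction (p ℕD.∣0) p∤0
    square≡1⇒±1 {suc i} 1+i<m _ square≡1 with p ℕD.∣? (2 ℕ.+ i)
    ... | no p∤2+i =
      inj₁ (cong suc (≡-mod⇒≡ i<m (ℕP.<-≤-trans (s≤s z≤n) 1+i<m) (cancel-mod (unitInverse p∤2+i) [2+i]i≡[2+i]0)))
      where
      i<m : i ℕ.< m
      i<m = ℕP.<-trans (ℕP.n<1+n i) 1+i<m
      [2+i]i≡[2+i]0 : + (2 ℕ.+ i) * + i ≡ + (2 ℕ.+ i) * + 0 mod m
      [2+i]i≡[2+i]0 = ≡-mod-trans ([2+i]i≡0 {i} square≡1) (≡-mod-reflexive (sym (ℤP.*-zeroʳ (+ (2 ℕ.+ i)))))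
    ... | yes p∣2+i = inj₂ (≡-mod⇒≡ 1+i<m m′<m (begin
      + suc i                   ≡⟨ shift i ⟩
      + (2 ℕ.+ i) - + 1         ≈⟨ +-cong-mod 2+i≡0 (≡-mod-refl {a = - + 1}) ⟩
      + 0 - + 1                 ≈⟨ m′≡-1 ⟨
      + m′                      ∎))
      where
      open ≡-mod-Reasoning m
      shift : ∀ i → + suc i ≡ + (2 ℕ.+ i) - + 1
      shift i = trans (ℤP.pos-+ 1 i) (trans (add-sub (+ i)) (cong (_- + 1) (sym (ℤP.pos-+ 2 i))))
        where
        add-sub : ∀ i → + 1 + i ≡ + 2 + i - + 1
        add-sub = solve-∀
      p∤i : ¬ p ∣ℕ i
      p∤i p∣i = ℕP.<⇒≱ 2<p (ℕD.∣⇒≤ (ℕD.∣m+n∣m⇒∣n (subst (p ∣ℕ_) (ℕP.+-comm 2 i) p∣2+i) p∣i))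
      2+i≡0 : + (2 ℕ.+ i) ≡ + 0 mod m
      2+i≡0 = cancel-mod (unitInverse p∤i) (begin
        + i * + (2 ℕ.+ i)  ≡⟨ ℤP.*-comm (+ i) (+ (2 ℕ.+ i)) ⟩
        + (2 ℕ.+ i) * + i  ≈⟨ [2+i]i≡0 {i} square≡1 ⟩
        + 0                ≡⟨ ℤP.*-zeroʳ (+ i) ⟨
        + i * + 0          ∎)

    fixed⇒±1 : ∀ {j} → j ℕ.< m → fixedPoints ι isUnit j ≡ true → j ≡ 1 ⊎ j ≡ m′
    fixed⇒±1 {j} j<m fixed with ∧-true⇒ (isUnit j) fixed
    ... | unit , ιj≟j = square≡1⇒±1 j<m (isUnit⇒∤ unit)
      (subst (λ i → + j * + i ≡ + 1 mod m) (does-true⇒ (ι j ℕ.≟ j) ιj≟j) (proj₂ (ι-spec (isUnit⇒∤ unit))))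

    ι-fixed : ∀ {j} → j ℕ.< m → ¬ p ∣ℕ j → + j * + j ≡ + 1 mod m → fixedPoints ι isUnit j ≡ true
    ι-fixed {j} j<m p∤j square≡1 =
      cong₂ _∧_ (∤⇒isUnit p∤j) (dec-true (ι j ℕ.≟ j) (solveMod-unique (unitInverse p∤j) j<m square≡1))

    fixedPoints-product : productOver (fixedPoints ι isUnit) m ≡ + m′
    fixedPoints-product = begin
      productOver F m                                  ≡⟨ productOver-remove m m′<m F[m′] ⟩
      + m′ * productOver (remove m′ F) m               ≡⟨ cong (+ m′ *_) (productOver-remove m 1<m F[1]) ⟩
      + m′ * (+ 1 * productOver (remove 1 (remove m′ F)) m)
        ≡⟨ cong (λ t → + m′ * (+ 1 * t)) (productOver-none m none) ⟩
      + m′ * (+ 1 * + 1)                               ≡⟨ ℤP.*-identityʳ (+ m′) ⟩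
      + m′                                             ∎
      where
      open ≡-Reasoning
      F = fixedPoints ι isUnit
      1<m : 1 ℕ.< m
      1<m = ℕP.<-trans 1<m′ m′<m
      F[m′] : F m′ ≡ true
      F[m′] = ι-fixed m′<m p∤m′ (*-cong-mod m′≡-1 m′≡-1)
      F[1] : remove m′ F 1 ≡ true
      F[1] = trans (remove-≢ F (ℕP.<⇒≢ 1<m′)) (ι-fixed 1<m p∤1 ≡-mod-refl)
      none : ∀ {j} → j ℕ.< m → remove 1 (remove m′ F) j ≡ false
      none {j} j<m = ¬-not λ removed →
        let F′j , j≢1 = remove-true (remove m′ F) removed
            Fj , j≢m′ = remove-true F F′j
        in [ j≢1 , j≢m′ ]′ (fixed⇒±1 j<m Fj)

  wilson : unitProduct p 0 m ≡ -1ℤ mod m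
  wilson = begin
    unitProduct p 0 m                     ≡⟨ unitProduct≡productOver-isUnit m ⟩
    productOver isUnit m                  ≈⟨ productOver-pairing ι ι-involutive ι-inverse m isUnit units-closed ⟩
    productOver (fixedPoints ι isUnit) m  ≡⟨ fixedPoints-product ⟩
    + m′                                  ≈⟨ m′≡-1 ⟩
    -1ℤ                                   ∎
    where open ≡-mod-Reasoning m

-- The reflection formula

module ReflectionFormula {p : ℕ} (p-prime : Prime p) (p≢2 : p ≢ 2) where

  private
    instance
      p≢0 : NonZero p
      p≢0 = prime⇒nonZero p-prime

    p-odd : -1ℤ ^ p ≡ -1ℤ
    p-odd = prime≢2⇒-1^p≡-1 p-prime p≢2

    ΓpNat-1 : ΓpNat p 1 ≡ -1ℤ
    ΓpNat-1 = cong (λ u → - (+ 1 * u)) (unitPart-∣ p (p ℕD.∣0))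

    residueSign-0 : ∀ {c} → + c ≡ + 0 mod p → residueSign p c ≡ + 1
    residueSign-0 c≡0 = trans (residueSign-cong p c≡0) (cong (-1ℤ ^_) (ℕDM.m<n⇒m%n≡m (ℕ.>-nonZero⁻¹ p)))

    residueSign-[-1] : ∀ {c} → + c ≡ - + 1 mod p → residueSign p c ≡ + 1
    residueSign-[-1] {c} c≡-1 = begin
      residueSign p c            ≡⟨ residueSign-cong p (≡-mod-trans c≡-1 -1≡p-1) ⟩
      -1ℤ ^ ((p ℕ.∸ 1) ℕ.% p)    ≡⟨ cong (-1ℤ ^_) (ℕDM.m<n⇒m%n≡m (subst ((p ℕ.∸ 1) ℕ.<_) 1+[p∸1]≡p (ℕP.n<1+n _))) ⟩
      -1ℤ ^ (p ℕ.∸ 1)            ≡⟨ -1^[1+n]≡-1⇒-1^n≡1 {p ℕ.∸ 1} (trans (cong (-1ℤ ^_) 1+[p∸1]≡p) p-odd) ⟩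
      + 1                        ∎
      where
      open ≡-Reasoning
      1+[p∸1]≡p : suc (p ℕ.∸ 1) ≡ p
      1+[p∸1]≡p = ℕP.m+[n∸m]≡n (ℕ.>-nonZero⁻¹ p)
      -1≡p-1 : - + 1 ≡ + (p ℕ.∸ 1) mod p
      -1≡p-1 = ≡-mod (divides -1ℤ
        (trans (simplify (+ (p ℕ.∸ 1))) (trans (cong (λ n → - + n) 1+[p∸1]≡p) (sym (ℤP.-1*i≡-i (+ p))))))
        where
        simplify : ∀ x → - + 1 - x ≡ - (+ 1 + x)
        simplify = solve-∀

    Γ-reflection-small : ∀ {N N̄ c} → N ℕ.+ N̄ ≡ 1 → + c ≡ - + N mod p → ΓpNat p N * ΓpNat p N̄ ≡ - residueSign p c
    Γ-reflection-small {0} {1} _ c≡0 =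
      trans (ℤP.*-identityˡ (ΓpNat p 1)) (trans ΓpNat-1 (cong -_ (sym (residueSign-0 c≡0))))
    Γ-reflection-small {1} {0} _ c≡-1 =
      trans (ℤP.*-identityʳ (ΓpNat p 1)) (trans ΓpNat-1 (cong -_ (sym (residueSign-[-1] c≡-1))))
    Γ-reflection-small {0} {0} ()
    Γ-reflection-small {0} {suc (suc _)} ()
    Γ-reflection-small {1} {suc _} ()
    Γ-reflection-small {suc (suc _)} ()

    Γ-reflection-large : ∀ k {N t c} → N ℕ.+ t ≡ p ℕ.^ suc k → + c ≡ - + N mod p →
                         ΓpNat p N * ΓpNat p (suc t) ≡ - residueSign p c mod p ℕ.^ suc k
    Γ-reflection-large k {N} {t} {c} N+t≡m c≡-N = begin
      ΓpNat p N * ΓpNat p (suc t)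
        ≈⟨ Γ-reflection-sum p {N = N} {t} p∣m (-1^[n^k]≡-1 {p} p-odd (suc k)) N+t≡m ⟩
      signProduct p t * unitProduct p 0 m
        ≈⟨ *-congˡ-mod (signProduct p t) (Wilson.wilson p-prime p≢2 k) ⟩
      signProduct p t * -1ℤ
        ≡⟨ cong (_* -1ℤ) (signProduct≡residueSign p p-odd t) ⟩
      residueSign p t * -1ℤ
        ≡⟨ trans (ℤP.*-comm (residueSign p t) -1ℤ) (ℤP.-1*i≡-i (residueSign p t)) ⟩
      - residueSign p t
        ≡⟨ cong -_ (residueSign-cong p t≡c) ⟩
      - residueSign p c ∎
      where
      open ≡-mod-Reasoning (p ℕ.^ suc k)
      m = p ℕ.^ suc k
      p∣m : p ∣ℕ m
      p∣m = ℕD.∣m⇒∣m*n (p ℕ.^ k) ℕD.∣-refl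
      t≡c : + t ≡ + c mod p
      t≡c = ≡-mod-trans t≡m-N (≡-mod-trans (+-cong-mod (∣⇒≡0-mod (∣ᵤ⇒∣ {i = + m} p∣m)) (≡-mod-refl {a = - + N}))
              (≡-mod-trans (≡-mod-reflexive (ℤP.+-identityˡ (- + N))) (≡-mod-sym c≡-N)))
        where
        t≡m-N : + t ≡ + m - + N mod p
        t≡m-N = ≡-mod-reflexive
          (trans (cancel (+ N) (+ t)) (cong (_- + N) (trans (sym (ℤP.pos-+ N t)) (cong +_ N+t≡m))))
          where
          cancel : ∀ N t → t ≡ N + t - N
          cancel = solve-∀

  Γ-reflection : ∀ k {N N̄ c} → N ℕ.< p ℕ.^ suc k → N̄ ℕ.< p ℕ.^ suc k →
                 + N + + N̄ ≡ + 1 mod p ℕ.^ suc k → + c ≡ - + N mod p →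
                 ΓpNat p N * ΓpNat p N̄ ≡ - residueSign p c mod p ℕ.^ suc k
  Γ-reflection k {N} {N̄} N<m N̄<m N+N̄≡1 c≡-N with +-≡-mod⇒≡⊎≡+ N<m N̄<m 1<m N+N̄≡1
    where
    1<m : 1 ℕ.< p ℕ.^ suc k
    1<m = ℕP.<-≤-trans (ℕ.nonTrivial⇒n>1 p {{prime⇒nonTrivial p-prime}})
            (ℕD.∣⇒≤ {{ℕP.m^n≢0 p (suc k)}} (ℕD.∣m⇒∣m*n (p ℕ.^ k) ℕD.∣-refl))
  ... | inj₁ N+N̄≡1 = ≡-mod-reflexive (Γ-reflection-small N+N̄≡1 c≡-N)
  Γ-reflection k {N} {zero} N<m _ _ _ | inj₂ N+0≡1+m =
    contradiction (trans (sym (ℕP.+-identityʳ N)) N+0≡1+m) (ℕP.<⇒≢ (ℕP.m<n⇒m<1+n N<m))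
  Γ-reflection k {N} {suc t} _ _ _ c≡-N | inj₂ N+1+t≡1+m =
    Γ-reflection-large k (ℕP.suc-injective (trans (sym (ℕP.+-suc N t)) N+1+t≡1+m)) c≡-N

  -- Γ_p(x) Γ_p(1 − x) modulo p^(k+1) for x = c/D, where c = 0 means x ∈ ℤ.
  reflectionSign : ℕ → ℤ
  reflectionSign zero = + 1
  reflectionSign (suc c) = - residueSign p (suc c)

  reflectionSign²≡1 : ∀ c → reflectionSign c * reflectionSign c ≡ + 1
  reflectionSign²≡1 zero = refl
  reflectionSign²≡1 (suc c) = begin
    - -1ℤ ^ r * - -1ℤ ^ r  ≡⟨ neg-square (-1ℤ ^ r) ⟩
    -1ℤ ^ r * -1ℤ ^ r      ≡⟨ ℤP.^-distribˡ-+-* -1ℤ r r ⟨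
    -1ℤ ^ (r ℕ.+ r)        ≡⟨ -1^[h+h]≡1 r ⟩
    + 1                    ∎
    where
    open ≡-Reasoning
    r = suc c ℕ.% p
    neg-square : ∀ x → - x * - x ≡ x * x
    neg-square = solve-∀

  reflectionSign-≡ : ∀ {c c′} → (c ≡ 0 → c′ ≡ 0) → (c′ ≡ 0 → c ≡ 0) →
                     residueSign p c ≡ residueSign p c′ → reflectionSign c ≡ reflectionSign c′
  reflectionSign-≡ {zero} {zero} _ _ _ = refl
  reflectionSign-≡ {zero} {suc _} c≡0⇒c′≡0 _ _ = contradiction (c≡0⇒c′≡0 refl) λ ()
  reflectionSign-≡ {suc _} {zero} _ c′≡0⇒c≡0 _ = contradiction (c′≡0⇒c≡0 refl) λ ()
  reflectionSign-≡ {suc _} {suc _} _ _ same = cong -_ same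

  p²-1 : ℕ
  p²-1 = p ℕ.∸ 1 ℕ.+ (p ℕ.∸ 1) ℕ.* p

  private
    p′ = p ℕ.∸ 1

    1+p′≡p : suc p′ ≡ p
    1+p′≡p = ℕP.m+[n∸m]≡n (ℕ.>-nonZero⁻¹ p)

    p²-1≡ : + p²-1 ≡ + p * + p - + 1
    p²-1≡ = begin
      + (p′ ℕ.+ p′ ℕ.* p)          ≡⟨ ℤP.pos-+ p′ (p′ ℕ.* p) ⟩
      + p′ + + (p′ ℕ.* p)          ≡⟨ cong (_+_ (+ p′)) (ℤP.pos-* p′ p) ⟩
      + p′ + + p′ * + p            ≡⟨ cong (λ P → + p′ + + p′ * P) P≡1+p′ ⟩
      + p′ + + p′ * (+ 1 + + p′)   ≡⟨ square (+ p′) ⟩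
      (+ 1 + + p′) * (+ 1 + + p′) - + 1  ≡⟨ cong (λ P → P * P - + 1) P≡1+p′ ⟨
      + p * + p - + 1              ∎
      where
      open ≡-Reasoning
      P≡1+p′ : + p ≡ + 1 + + p′
      P≡1+p′ = trans (cong +_ (sym 1+p′≡p)) (ℤP.pos-+ 1 p′)
      square : ∀ x → x + x * (+ 1 + x) ≡ (+ 1 + x) * (+ 1 + x) - + 1
      square = solve-∀

    p*[u+vp]≡v+up : ∀ u v → + p * + (u ℕ.+ v ℕ.* p) ≡ + (v ℕ.+ u ℕ.* p) mod p²-1
    p*[u+vp]≡v+up u v = ≡-mod (divides (+ v) (begin
      + p * + (u ℕ.+ v ℕ.* p) - + (v ℕ.+ u ℕ.* p)
        ≡⟨ cong₂ (λ x y → + p * x - y) (lift-+* u v) (lift-+* v u) ⟩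
      + p * (+ u + + v * + p) - (+ v + + u * + p)  ≡⟨ swap-digits (+ p) (+ u) (+ v) ⟩
      + v * (+ p * + p - + 1)                      ≡⟨ cong (+ v *_) p²-1≡ ⟨
      + v * + p²-1                                 ∎))
      where
      open ≡-Reasoning
      lift-+* : ∀ a b → + (a ℕ.+ b ℕ.* p) ≡ + a + + b * + p
      lift-+* a b = trans (ℤP.pos-+ a (b ℕ.* p)) (cong (_+_ (+ a)) (ℤP.pos-* b p))
      swap-digits : ∀ P U V → P * (U + V * P) - (V + U * P) ≡ V * (P * P - + 1)
      swap-digits = solve-∀

    digits-swap-< : ∀ {u v} → u ℕ.< p → v ℕ.< p → u ℕ.+ v ℕ.* p ℕ.< p²-1 → v ℕ.+ u ℕ.* p ℕ.< p²-1
    digits-swap-< {u} {v} u<p v<p u+vp<p²-1 with ℕP.m≤n⇒m<n∨m≡n (ℕP.≤-pred (subst (u ℕ.<_) (sym 1+p′≡p) u<p))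
    ... | inj₁ u<p′ = ℕP.+-mono-≤-< v≤p′ (ℕP.*-monoˡ-< p u<p′)
      where
      v≤p′ : v ℕ.≤ p′
      v≤p′ = ℕP.≤-pred (subst (v ℕ.<_) (sym 1+p′≡p) v<p)
    ... | inj₂ refl = ℕP.+-monoˡ-< (p′ ℕ.* p) (ℕP.*-cancelʳ-< p v p′ (ℕP.+-cancelˡ-< p′ _ _ u+vp<p²-1))

    even⇒digits-same-parity : ∀ u v → 2 ∣ℕ u ℕ.+ v ℕ.* p → -1ℤ ^ u ≡ -1ℤ ^ v
    even⇒digits-same-parity u v 2∣u+vp = -1^a*-1^b≡1⇒-1^a≡-1^b {u} {v} (begin
      -1ℤ ^ u * -1ℤ ^ v             ≡⟨ cong (λ s → -1ℤ ^ u * s ^ v) p-odd ⟨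
      -1ℤ ^ u * (-1ℤ ^ p) ^ v       ≡⟨ cong (-1ℤ ^ u *_) (trans (ℤP.^-*-assoc -1ℤ p v) (cong (-1ℤ ^_) (ℕP.*-comm p v))) ⟩
      -1ℤ ^ u * -1ℤ ^ (v ℕ.* p)     ≡⟨ ℤP.^-distribˡ-+-* -1ℤ u (v ℕ.* p) ⟨
      -1ℤ ^ (u ℕ.+ v ℕ.* p)         ≡⟨ 2∣n⇒-1^n≡1 2∣u+vp ⟩
      + 1                           ∎)
      where open ≡-Reasoning

  reflectionSign-swap : ∀ {c c′} → c ℕ.< p²-1 → c′ ℕ.< p²-1 → + c′ ≡ + p * + c mod p²-1 → 2 ∣ℕ c →
                        reflectionSign c ≡ reflectionSign c′
  reflectionSign-swap {c} {c′} c<p²-1 c′<p²-1 c′≡pc 2∣c = reflectionSign-≡ c≡0⇒c′≡0 c′≡0⇒c≡0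
    (trans (even⇒digits-same-parity u v (subst (2 ∣ℕ_) c≡u+vp 2∣c)) (cong (-1ℤ ^_) v≡c′%p))
    where
    u = c ℕ.% p
    v = c ℕ./ p
    c≡u+vp : c ≡ u ℕ.+ v ℕ.* p
    c≡u+vp = ℕDM.m≡m%n+[m/n]*n c p
    v<p : v ℕ.< p
    v<p = ℕDM.m<n*o⇒m/o<n (ℕP.<-trans c<p²-1 p²-1<p*p)
      where
      p²-1<p*p : p²-1 ℕ.< p ℕ.* p
      p²-1<p*p = subst (p²-1 ℕ.<_) (trans (cong (ℕ._+ p′ ℕ.* p) 1+p′≡p) (cong (ℕ._* p) 1+p′≡p))
                   (ℕP.+-monoˡ-< (p′ ℕ.* p) (ℕP.n<1+n p′))
    c′≡v+up : c′ ≡ v ℕ.+ u ℕ.* p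
    c′≡v+up = ≡-mod⇒≡ c′<p²-1 (digits-swap-< (ℕDM.m%n<n c p) v<p (subst (ℕ._< p²-1) c≡u+vp c<p²-1))
      (≡-mod-trans c′≡pc (subst (λ x → + p * + x ≡ + (v ℕ.+ u ℕ.* p) mod p²-1) (sym c≡u+vp) (p*[u+vp]≡v+up u v)))
    v≡c′%p : v ≡ c′ ℕ.% p
    v≡c′%p = sym (trans (cong (ℕ._% p) c′≡v+up) (trans (ℕDM.[m+kn]%n≡m%n v u p) (ℕDM.m<n⇒m%n≡m v<p)))
    c≡0⇒c′≡0 : c ≡ 0 → c′ ≡ 0
    c≡0⇒c′≡0 refl = ≡-mod⇒≡ c′<p²-1 c<p²-1 (≡-mod-trans c′≡pc (≡-mod-reflexive (ℤP.*-zeroʳ (+ p))))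
    c′≡0⇒c≡0 : c′ ≡ 0 → c ≡ 0
    c′≡0⇒c≡0 c′≡0 = trans c≡u+vp (cong₂ (λ x y → x ℕ.+ y ℕ.* p) u≡0 v≡0)
      where
      v+up≡0 : v ℕ.+ u ℕ.* p ≡ 0
      v+up≡0 = trans (sym c′≡v+up) c′≡0
      v≡0 : v ≡ 0
      v≡0 = ℕP.m+n≡0⇒m≡0 v v+up≡0
      u≡0 : u ≡ 0
      u≡0 = ℕP.m*n≡0⇒m≡0 u p (ℕP.m+n≡0⇒n≡0 v v+up≡0)

  module _ (k : ℕ) {D : ℕ} (D≡-1 : + D ≡ - + 1 mod p) where

    private
      m : ℕ
      m = p ℕ.^ suc k

      p∣m : p ∣ℕ m
      p∣m = ℕD.∣m⇒∣m*n (p ℕ.^ k) ℕD.∣-refl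

      p∤D : ¬ p ∣ℕ D
      p∤D p∣D = ℕ.nonTrivial⇒≢1 {{prime⇒nonTrivial p-prime}}
        (ℕD.∣1⇒≡1 (∣⇒∣ᵤ (∣-diff (≡-mod-trans (≡-mod-sym (∣⇒≡0-mod (∣ᵤ⇒∣ {i = + D} p∣D))) D≡-1))))

      instance
        D≢0 : NonZero D
        D≢0 = ℕ.≢-nonZero λ D≡0 → p∤D (subst (p ∣ℕ_) (sym D≡0) (p ℕD.∣0))

      D-inverse : Invertible m (+ D)
      D-inverse = ∤⇒invertible-mod-prime^ p-prime p∤D (suc k)

      residue-0 : ∀ {q} → q ≃ + 0 / D → residue m q ≡ 0
      residue-0 {q} q≃0 = ≡-mod⇒≡ N<m (ℕP.≤-<-trans z≤n N<m)
        (cancel-mod D-inverse (≡-mod-trans DN≡0 (≡-mod-reflexive (sym (ℤP.*-zeroʳ (+ D))))))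
        where
        N<m = proj₁ (residue-≃ p-prime (suc k) q≃0 p∤D)
        DN≡0 = proj₂ (residue-≃ p-prime (suc k) q≃0 p∤D)

      0<D : 0 ℕ.< D
      0<D = ℕ.>-nonZero⁻¹ D

    Γ-reflection-numerators : ∀ {u ū c c̄} → c ℕ.< D → c̄ ℕ.< D → + c + + c̄ ≡ + 0 mod D →
                              frac u ≃ + c / D → frac ū ≃ + c̄ / D →
                              ΓpMod p (suc k) (frac u) * ΓpMod p (suc k) (frac ū) ≡ reflectionSign c mod m
    Γ-reflection-numerators {u} {ū} {zero} {c̄} _ c̄<D c+c̄≡0 fu≃0 fū≃c̄ =
      ≡-mod-reflexive (cong₂ (λ N N̄ → ΓpNat p N * ΓpNat p N̄)
        (residue-0 fu≃0) (residue-0 (subst (λ c → frac ū ≃ + c / D) c̄≡0 fū≃c̄)))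
      where
      c̄≡0 : c̄ ≡ 0
      c̄≡0 = [ id , (λ c̄≡D → contradiction c̄≡D (ℕP.<⇒≢ c̄<D)) ]′ (+-≡-mod⇒≡⊎≡+ 0<D c̄<D 0<D c+c̄≡0)
    Γ-reflection-numerators {u} {ū} {suc c′} {c̄} c<D c̄<D c+c̄≡0 fu≃c fū≃c̄ =
      Γ-reflection k N<m N̄<m N+N̄≡1 c≡-N
      where
      N = residue m (frac u)
      N̄ = residue m (frac ū)
      N<m = proj₁ (residue-≃ p-prime (suc k) fu≃c p∤D)
      DN≡c = proj₂ (residue-≃ p-prime (suc k) fu≃c p∤D)
      N̄<m = proj₁ (residue-≃ p-prime (suc k) fū≃c̄ p∤D)
      DN̄≡c̄ = proj₂ (residue-≃ p-prime (suc k) fū≃c̄ p∤D)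
      c+c̄≡D : suc c′ ℕ.+ c̄ ≡ D
      c+c̄≡D = [ (λ ()) , id ]′ (+-≡-mod⇒≡⊎≡+ c<D c̄<D 0<D c+c̄≡0)
      N+N̄≡1 : + N + + N̄ ≡ + 1 mod m
      N+N̄≡1 = cancel-mod D-inverse (begin
        + D * (+ N + + N̄)        ≡⟨ ℤP.*-distribˡ-+ (+ D) (+ N) (+ N̄) ⟩
        + D * + N + + D * + N̄    ≈⟨ +-cong-mod DN≡c DN̄≡c̄ ⟩
        + suc c′ + + c̄           ≡⟨ cong +_ c+c̄≡D ⟩
        + D                      ≡⟨ ℤP.*-identityʳ (+ D) ⟨
        + D * + 1                ∎)
        where open ≡-mod-Reasoning m
      c≡-N : + suc c′ ≡ - + N mod p
      c≡-N = begin
        + suc c′       ≈⟨ ≡-mod-∣ p∣m DN≡c ⟨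
        + D * + N      ≈⟨ *-congʳ-mod (+ N) D≡-1 ⟩
        - + 1 * + N    ≡⟨ ℤP.-1*i≡-i (+ N) ⟩
        - + N          ∎
        where open ≡-mod-Reasoning p

    Γ-reflection-frac : ∀ {u ū X X̄} → u ≃ X / D → ū ≃ X̄ / D → X + X̄ ≡ + 0 mod D →
                        ∃[ c ] c ℕ.< D × X ≡ + c mod D ×
                          ΓpMod p (suc k) (frac u) * ΓpMod p (suc k) (frac ū) ≡ reflectionSign c mod m
    Γ-reflection-frac {u} {ū} u≃X/D ū≃X̄/D X+X̄≡0 =
      let c , c<D , X≡c , fu≃c = frac-≃ u≃X/D
          c̄ , c̄<D , X̄≡c̄ , fū≃c̄ = frac-≃ ū≃X̄/D
          c+c̄≡0 = ≡-mod-trans (+-cong-mod (≡-mod-sym X≡c) (≡-mod-sym X̄≡c̄)) X+X̄≡0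
      in c , c<D , X≡c , Γ-reflection-numerators {u} {ū} c<D c̄<D c+c̄≡0 fu≃c fū≃c̄

module Lemma2p15 {p d e : ℕ} (p-prime : Prime p) (p≢2 : p ≢ 2) .{{_ : NonZero d}}
                 (p+1≡ed : p ℕ.+ 1 ≡ e ℕ.* d) (n k : ℕ) where

  open ReflectionFormula p-prime p≢2

  private
    m = p ℕ.^ suc k
    D = p²-1

    instance
      p≢0 : NonZero p
      p≢0 = prime⇒nonZero p-prime
      p∸1≢0 : NonZero (p ℕ.∸ 1)
      p∸1≢0 = ℕ.>-nonZero (ℕP.m<n⇒0<n∸m (ℕ.nonTrivial⇒n>1 p {{prime⇒nonTrivial p-prime}}))

    Γ : ℚ → ℤ
    Γ q = ΓpMod p (suc k) (frac q)

    numerator : ℤ → ℤ → ℤ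
    numerator a Y = (a * + (p ℕ.∸ 1) + Y * + d) * + e

    D≡e[d[p∸1]] : D ≡ e ℕ.* (d ℕ.* (p ℕ.∸ 1))
    D≡e[d[p∸1]] = begin
      p ℕ.∸ 1 ℕ.+ (p ℕ.∸ 1) ℕ.* p  ≡⟨ factor (p ℕ.∸ 1) p ⟩
      (p ℕ.∸ 1) ℕ.* (p ℕ.+ 1)      ≡⟨ cong ((p ℕ.∸ 1) ℕ.*_) p+1≡ed ⟩
      (p ℕ.∸ 1) ℕ.* (e ℕ.* d)      ≡⟨ reorder (p ℕ.∸ 1) e d ⟩
      e ℕ.* (d ℕ.* (p ℕ.∸ 1))      ∎
      where
      open ≡-Reasoning
      factor : ∀ x p → x ℕ.+ x ℕ.* p ≡ x ℕ.* (p ℕ.+ 1)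
      factor = ℕSolver.solve-∀
      reorder : ∀ x e d → x ℕ.* (e ℕ.* d) ≡ e ℕ.* (d ℕ.* x)
      reorder = ℕSolver.solve-∀

    D≡[e[p∸1]]d : D ≡ e ℕ.* (p ℕ.∸ 1) ℕ.* d
    D≡[e[p∸1]]d = trans D≡e[d[p∸1]] (reorder e d (p ℕ.∸ 1))
      where
      reorder : ∀ e d x → e ℕ.* (d ℕ.* x) ≡ e ℕ.* x ℕ.* d
      reorder = ℕSolver.solve-∀

    shifted-≃ : ∀ a {r Y} → r ≃ Y / (p ℕ.∸ 1) → ((a ÷ℕ d) ℚ.+ r) ≃ numerator a Y / D
    shifted-≃ a r≃Y = ≃-scale {{ℕP.m*n≢0 d (p ℕ.∸ 1)}} (+-≃ (÷ℕ-≃ a d) r≃Y) e D≡e[d[p∸1]]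

    unshifted-≃ : ∀ a → (a ÷ℕ d) ≃ (a * + (e ℕ.* (p ℕ.∸ 1))) / D
    unshifted-≃ a = ≃-scale (÷ℕ-≃ a d) (e ℕ.* (p ℕ.∸ 1)) D≡[e[p∸1]]d

    Q : ℤ
    Q = + (p ℕ.∸ 1)

    h = proj₁ (prime≢2⇒odd p-prime p≢2)

    Q≡h+h : Q ≡ + h + + h
    Q≡h+h = trans (cong (λ x → + (x ℕ.∸ 1)) (proj₂ (prime≢2⇒odd p-prime p≢2))) (ℤP.pos-+ h h)

    p≡1+Q : + p ≡ + 1 + Q
    p≡1+Q = trans (cong +_ (sym (ℕP.m+[n∸m]≡n (ℕ.>-nonZero⁻¹ p)))) (ℤP.pos-+ 1 (p ℕ.∸ 1))

    ed≡Q+2 : + e * + d ≡ Q + + 2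
    ed≡Q+2 = begin
      + e * + d      ≡⟨ ℤP.pos-* e d ⟨
      + (e ℕ.* d)    ≡⟨ cong +_ p+1≡ed ⟨
      + (p ℕ.+ 1)    ≡⟨ ℤP.pos-+ p 1 ⟩
      + p + + 1      ≡⟨ cong (_+ + 1) p≡1+Q ⟩
      + 1 + Q + + 1  ≡⟨ reorder Q ⟩
      Q + + 2        ∎
      where
      open ≡-Reasoning
      reorder : ∀ Q → + 1 + Q + + 1 ≡ Q + + 2
      reorder = solve-∀

    D≡Q[Q+2] : + D ≡ Q * (Q + + 2)
    D≡Q[Q+2] = begin
      + (p ℕ.∸ 1 ℕ.+ (p ℕ.∸ 1) ℕ.* p)  ≡⟨ ℤP.pos-+ (p ℕ.∸ 1) _ ⟩
      Q + + ((p ℕ.∸ 1) ℕ.* p)          ≡⟨ cong (_+_ Q) (ℤP.pos-* (p ℕ.∸ 1) p) ⟩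
      Q + Q * + p                      ≡⟨ cong (λ P → Q + Q * P) p≡1+Q ⟩
      Q + Q * (+ 1 + Q)                ≡⟨ factor Q ⟩
      Q * (Q + + 2)                    ∎
      where
      open ≡-Reasoning
      factor : ∀ Q → Q + Q * (+ 1 + Q) ≡ Q * (Q + + 2)
      factor = solve-∀

    d∸1≡d-1 : + (d ℕ.∸ 1) ≡ + d - + 1
    d∸1≡d-1 = sym (trans (ℤP.m-n≡m⊖n d 1) (ℤP.⊖-≥ (ℕ.>-nonZero⁻¹ d)))

    X₁ X₂ Z₁ Z₂ : ℤ
    X₁ = numerator (- + 1) (+ n)
    X₂ = numerator (- + (d ℕ.∸ 1)) (+ n)
    Z₁ = + 1 * + (e ℕ.* (p ℕ.∸ 1))
    Z₂ = + (d ℕ.∸ 1) * + (e ℕ.* (p ℕ.∸ 1))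

    D≡-1 : + D ≡ - + 1 mod p
    D≡-1 = ≡-mod (divides (+ p) (begin
      + D - - + 1              ≡⟨ cong (_- - + 1) D≡Q[Q+2] ⟩
      Q * (Q + + 2) - - + 1    ≡⟨ complete-square Q ⟩
      (+ 1 + Q) * (+ 1 + Q)    ≡⟨ cong (λ P → P * P) p≡1+Q ⟨
      + p * + p                ∎))
      where
      open ≡-Reasoning
      complete-square : ∀ Q → Q * (Q + + 2) - - + 1 ≡ (+ 1 + Q) * (+ 1 + Q)
      complete-square = solve-∀

    opposite : ∀ a → numerator (- a) (+ n) + numerator a (- + n) ≡ + 0 mod D
    opposite a = ≡-mod-reflexive (cancel a Q (+ d) (+ e) (+ n))
      where
      cancel : ∀ a Q d e n → (- a * Q + n * d) * e + (a * Q + - n * d) * e ≡ + 0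
      cancel = solve-∀

    Z₁+Z₂≡0 : Z₁ + Z₂ ≡ + 0 mod D
    Z₁+Z₂≡0 = begin
      Z₁ + Z₂                                 ≡⟨ ℤP.*-distribʳ-+ K (+ 1) (+ (d ℕ.∸ 1)) ⟨
      (+ 1 + + (d ℕ.∸ 1)) * K
        ≡⟨ cong (_* K) (trans (sym (ℤP.pos-+ 1 (d ℕ.∸ 1))) (cong +_ (ℕP.m+[n∸m]≡n (ℕ.>-nonZero⁻¹ d)))) ⟩
      + d * K                                 ≡⟨ ℤP.*-comm (+ d) K ⟩
      K * + d                                 ≡⟨ ℤP.pos-* (e ℕ.* (p ℕ.∸ 1)) d ⟨
      + (e ℕ.* (p ℕ.∸ 1) ℕ.* d)               ≡⟨ cong +_ D≡[e[p∸1]]d ⟨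
      + D                                     ≈⟨ ∣⇒≡0-mod ∣-refl ⟩
      + 0                                     ∎
      where
      open ≡-mod-Reasoning D
      K = + (e ℕ.* (p ℕ.∸ 1))

    pX₁≡X₂ : + p * X₁ ≡ X₂ mod D
    pX₁≡X₂ = ≡-mod (divides (+ 1 + + n - + e) (begin
      + p * X₁ - X₂
        ≡⟨ cong₂ (λ P d-1 → P * numerator (- + 1) (+ n) - numerator (- d-1) (+ n)) p≡1+Q d∸1≡d-1 ⟩
      (+ 1 + Q) * ((- + 1 * Q + + n * + d) * + e) - ((- (+ d - + 1) * Q + + n * + d) * + e)
        ≡⟨ expand Q (+ d) (+ e) (+ n) ⟩
      (+ 1 + + n - + e) * (Q * (Q + + 2)) + Q * (+ 1 + + n) * (+ e * + d - (Q + + 2))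
        ≡⟨ cong (λ t → (+ 1 + + n - + e) * (Q * (Q + + 2)) + Q * (+ 1 + + n) * (t - (Q + + 2))) ed≡Q+2 ⟩
      (+ 1 + + n - + e) * (Q * (Q + + 2)) + Q * (+ 1 + + n) * ((Q + + 2) - (Q + + 2))
        ≡⟨ cancel (+ 1 + + n - + e) (Q * (Q + + 2)) (Q * (+ 1 + + n)) (Q + + 2) ⟩
      (+ 1 + + n - + e) * (Q * (Q + + 2))
        ≡⟨ cong ((+ 1 + + n - + e) *_) D≡Q[Q+2] ⟨
      (+ 1 + + n - + e) * + D ∎))
      where
      open ≡-Reasoning
      expand : ∀ Q d e n →
        (+ 1 + Q) * ((- + 1 * Q + n * d) * e) - ((- (d - + 1) * Q + n * d) * e) ≡
        (+ 1 + n - e) * (Q * (Q + + 2)) + Q * (+ 1 + n) * (e * d - (Q + + 2))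
      expand = solve-∀
      cancel : ∀ a b c t → a * b + c * (t - t) ≡ a * b
      cancel = solve-∀

    2∣X₁ : + 2 ∣ X₁
    2∣X₁ = divides (+ n * (+ h + + 1) - + h * + e) (begin
      (- + 1 * Q + + n * + d) * + e            ≡⟨ regroup Q (+ d) (+ e) (+ n) ⟩
      - Q * + e + + n * (+ e * + d)
        ≡⟨ cong₂ (λ q t → - q * + e + + n * t) Q≡h+h (trans ed≡Q+2 (cong (_+ + 2) Q≡h+h)) ⟩
      - (+ h + + h) * + e + + n * (+ h + + h + + 2)  ≡⟨ halve (+ h) (+ e) (+ n) ⟩
      (+ n * (+ h + + 1) - + h * + e) * + 2    ∎)
      where
      open ≡-Reasoning
      regroup : ∀ Q d e n → (- + 1 * Q + n * d) * e ≡ - Q * e + n * (e * d)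
      regroup = solve-∀
      halve : ∀ h e n → - (h + h) * e + n * (h + h + + 2) ≡ (n * (h + + 1) - h * e) * + 2
      halve = solve-∀

    2∣D : 2 ∣ℕ D
    2∣D = ∣⇒∣ᵤ (divides (+ h * (+ h + + h + + 2)) (begin
      + D                            ≡⟨ D≡Q[Q+2] ⟩
      Q * (Q + + 2)                  ≡⟨ cong (λ q → q * (q + + 2)) Q≡h+h ⟩
      (+ h + + h) * (+ h + + h + + 2) ≡⟨ halve (+ h) ⟩
      + h * (+ h + + h + + 2) * + 2  ∎))
      where
      open ≡-Reasoning
      halve : ∀ h → (h + h) * (h + h + + 2) ≡ h * (h + h + + 2) * + 2
      halve = solve-∀

    pairs : ∀ {g₁ g₂ g₃ g₄ h₁ h₂ s t} → g₁ * g₃ ≡ s mod m → g₂ * g₄ ≡ s mod m → h₁ * h₂ ≡ t mod m →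
            s * s ≡ + 1 → t * t ≡ + 1 → g₁ * g₂ * g₃ * g₄ ≡ h₁ * h₁ * h₂ * h₂ mod m
    pairs {g₁} {g₂} {g₃} {g₄} {h₁} {h₂} {s} {t} g₁g₃≡s g₂g₄≡s h₁h₂≡t s²≡1 t²≡1 = begin
      g₁ * g₂ * g₃ * g₄              ≡⟨ regroup g₁ g₂ g₃ g₄ ⟩
      (g₁ * g₃) * (g₂ * g₄)          ≈⟨ *-cong-mod g₁g₃≡s g₂g₄≡s ⟩
      s * s                          ≡⟨ trans s²≡1 (sym t²≡1) ⟩
      t * t                          ≈⟨ *-cong-mod h₁h₂≡t h₁h₂≡t ⟨
      (h₁ * h₂) * (h₁ * h₂)          ≡⟨ regroup h₁ h₁ h₂ h₂ ⟨
      h₁ * h₁ * h₂ * h₂              ∎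
      where
      open ≡-mod-Reasoning m
      regroup : ∀ a b c d → a * b * c * d ≡ (a * c) * (b * d)
      regroup = solve-∀

    2∣numerator : ∀ {c} → X₁ ≡ + c mod D → 2 ∣ℕ c
    2∣numerator {c} X₁≡c = ∣⇒∣ᵤ (≡0-mod⇒∣ (begin
      + c   ≈⟨ ≡-mod-∣ 2∣D X₁≡c ⟨
      X₁    ≈⟨ ∣⇒≡0-mod 2∣X₁ ⟩
      + 0   ∎))
      where open ≡-mod-Reasoning 2

    a₁ a₂ a₃ a₄ z₁ z₂ : ℚ
    a₁ = ((- + 1) ÷ℕ d) ℚ.+ ((+ n) ÷ℕ (p ℕ.∸ 1))
    a₂ = ((- + (d ℕ.∸ 1)) ÷ℕ d) ℚ.+ ((+ n) ÷ℕ (p ℕ.∸ 1))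
    a₃ = ((+ 1) ÷ℕ d) ℚ.- ((+ n) ÷ℕ (p ℕ.∸ 1))
    a₄ = ((+ (d ℕ.∸ 1)) ÷ℕ d) ℚ.- ((+ n) ÷ℕ (p ℕ.∸ 1))
    z₁ = (+ 1) ÷ℕ d
    z₂ = (+ (d ℕ.∸ 1)) ÷ℕ d

  Γ-product-identity : Γ a₁ * Γ a₂ * Γ a₃ * Γ a₄ ≡ Γ z₁ * Γ z₁ * Γ z₂ * Γ z₂ mod m
  Γ-product-identity =
    let c₁ , c₁<D , X₁≡c₁ , Γ₁₃ = Γ-reflection-frac k D≡-1
          (shifted-≃ (- + 1) n≃) (shifted-≃ (+ 1) (neg-≃ n≃)) (opposite (+ 1))
        c₂ , c₂<D , X₂≡c₂ , Γ₂₄ = Γ-reflection-frac k D≡-1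
          (shifted-≃ (- + (d ℕ.∸ 1)) n≃) (shifted-≃ (+ (d ℕ.∸ 1)) (neg-≃ n≃)) (opposite (+ (d ℕ.∸ 1)))
        c , _ , _ , Γz₁z₂ = Γ-reflection-frac k D≡-1 (unshifted-≃ (+ 1)) (unshifted-≃ (+ (d ℕ.∸ 1))) Z₁+Z₂≡0
        c₂≡pc₁ = ≡-mod-trans (≡-mod-sym X₂≡c₂) (≡-mod-trans (≡-mod-sym pX₁≡X₂) (*-congˡ-mod (+ p) X₁≡c₁))
        same-sign = reflectionSign-swap c₁<D c₂<D c₂≡pc₁ (2∣numerator X₁≡c₁)
    in pairs {Γ a₁} {Γ a₂} {Γ a₃} {Γ a₄} {Γ z₁} {Γ z₂}
         Γ₁₃ (≡-mod-trans Γ₂₄ (≡-mod-reflexive (sym same-sign))) Γz₁z₂ (reflectionSign²≡1 c₁) (reflectionSign²≡1 c)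
    where
    n≃ : ((+ n) ÷ℕ (p ℕ.∸ 1)) ≃ + n / (p ℕ.∸ 1)
    n≃ = ÷ℕ-≃ (+ n) (p ℕ.∸ 1)

lemma2p15 : (p d : ℕ) → Prime p → p ≢ 2 → 1 ℕ.≤ d → d ∣ℕ (p ℕ.+ 1) →
  (n : ℕ) → n ℕ.≤ p ℕ.∸ 2 → (k : ℕ) →
  (+ (p ℕ.^ k)) ℤD.∣
    ((ΓpMod p k (frac (((- + 1) ÷ℕ d) ℚ.+ ((+ n) ÷ℕ (p ℕ.∸ 1))))
      ℤ.* ΓpMod p k (frac (((- + (d ℕ.∸ 1)) ÷ℕ d) ℚ.+ ((+ n) ÷ℕ (p ℕ.∸ 1))))
      ℤ.* ΓpMod p k (frac (((+ 1) ÷ℕ d) ℚ.- ((+ n) ÷ℕ (p ℕ.∸ 1))))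
      ℤ.* ΓpMod p k (frac (((+ (d ℕ.∸ 1)) ÷ℕ d) ℚ.- ((+ n) ÷ℕ (p ℕ.∸ 1)))))
    ℤ.- (ΓpMod p k (frac ((+ 1) ÷ℕ d)) ℤ.* ΓpMod p k (frac ((+ 1) ÷ℕ d))
      ℤ.* ΓpMod p k (frac ((+ (d ℕ.∸ 1)) ÷ℕ d)) ℤ.* ΓpMod p k (frac ((+ (d ℕ.∸ 1)) ÷ℕ d))))
lemma2p15 p d p-prime p≢2 1≤d d∣p+1 n _ zero = ℕD.1∣ _
lemma2p15 p (suc d′) p-prime p≢2 _ (ℕD.divides e p+1≡ed) n _ (suc k) =
  ∣⇒∣ᵤ (∣-diff (Lemma2p15.Γ-product-identity {p} {suc d′} {e} p-prime p≢2 p+1≡ed n k))
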